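{- Let $k\ge3$, $V=\{x_1,\dots,x_k\}$, and let $C=\ell_1\vee\cdots\vee\ell_k$ be a clause of width $k$ over $V$. Let $\alpha_{\mathsf{start}},\alpha_{\mathsf{end}}\colon V\to\{0,1\}$ be assignments each of which makes exactly one literal of $C$ true, and suppose $\alpha_{\mathsf{start}}=\alpha_{\mathsf{end}}$. Let $\alpha_{\mathsf{rand}}\colon V\to\{0,1\}$ be uniformly random and, conditioned on it, let $\vec{\alpha_1}$ and $\vec{\alpha_2}$ be uniformly random from $\mathscr{A}(\alpha_{\mathsf{start}}\leftrightsquigarrow\alpha_{\mathsf{rand}})$ and $\mathscr{A}(\alpha_{\mathsf{rand}}\leftrightsquigarrow\alpha_{\mathsf{end}})$, respectively. Then, with $K:=k-1$, $$\Pr\bigl[\vec{\alpha_1}\circ\vec{\alpha_2}\text{ satisfies } C\bigr]=\sum_{0\le j\le K}\frac12\cdot\frac{\binom{K}{j}}{2^K}\left[\left(\frac{j}{j+1}\right)^2+1\right]\ge1-\frac2k.$$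
   Context: A reconfiguration sequence from $\alpha$ to $\beta$ is a sequence of assignments starting at $\alpha$, ending at $\beta$, consecutive ones differing in at most one variable; it satisfies $C$ if every assignment in it satisfies $C$. A reconfiguration sequence $(\alpha^{(1)},\dots,\alpha^{(T)})$ from $\alpha$ to $\beta$ is irredundant if no two consecutive assignments are identical and for each variable $x_i$ there is $t_i$ with $\alpha^{(t)}(x_i)=\alpha(x_i)$ for $t\le t_i$ and $\alpha^{(t)}(x_i)=\beta(x_i)$ for $t>t_i$. $\mathscr{A}(\alpha\leftrightsquigarrow\beta)$ denotes the set of irredundant reconfiguration sequences from $\alpha$ to $\beta$; $\circ$ denotes concatenation. -}

module Defs where

import Data.Bool
open import Data.Bool using (Bool; true; false; _∧_; _∨_; not; if_then_else_)
open import Data.Nat as ℕ using (ℕ; zero; suc; _∸_; _≡ᵇ_; _<ᵇ_)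
import Data.Nat.Combinatorics as Comb
open import Data.Fin using (Fin)
open import Data.Vec as V using (Vec; []; _∷_)
open import Data.List as L using (List; []; _∷_; _++_; length; filter; allFin; upTo; foldr; concatMap)
open import Data.Integer as ℤ using (+_)
open import Data.Rational as ℚ using (ℚ; _/_; 0ℚ; 1ℚ)
open import Relation.Nullary.Decidable using (does)
open import Function using (_∘_)
import Data.Bool.ListAction as BL
open import Relation.Nullary.Decidable.Core using (T?)
open import Data.Product using (proj₁; proj₂)

-- Assignments V → {0,1}, variable x_i ↦ position i
Assignment : ℕ → Set
Assignment k = Vec Bool k

-- A clause of width k over V = {x_1..x_k}: literal ℓ_i is on x_i, with polarity s_i
-- (ℓ_i = x_i if s_i = true, ℓ_i = ¬x_i if s_i = false).
Clause : ℕ → Set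
Clause k = Vec Bool k

_==_ : Bool → Bool → Bool
true == b = b
false == b = not b

litTrue : ∀ {k} → Clause k → Assignment k → Fin k → Bool
litTrue C α i = V.lookup C i == V.lookup α i

numTrueLits : ∀ {k} → Clause k → Assignment k → ℕ
numTrueLits {k} C α = length (filter (λ i → T? (litTrue C α i)) (allFin k))

satisfies : ∀ {k} → Assignment k → Clause k → Bool
satisfies {k} α C = BL.any (litTrue C α) (allFin k)

seqSatisfies : ∀ {k} → List (Assignment k) → Clause k → Bool
seqSatisfies σ C = BL.all (λ a → satisfies a C) σ

eqAssign : ∀ {k} → Assignment k → Assignment k → Bool
eqAssign [] [] = true
eqAssign (a ∷ as) (b ∷ bs) = (a == b) ∧ eqAssign as bs

hamming : ∀ {k} → Assignment k → Assignment k → ℕ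
hamming [] [] = 0
hamming (a ∷ as) (b ∷ bs) = (if a == b then 0 else 1) ℕ.+ hamming as bs

headIs : ∀ {k} → Assignment k → List (Assignment k) → Bool
headIs α [] = false
headIs α (a ∷ _) = eqAssign a α

lastIs : ∀ {k} → Assignment k → List (Assignment k) → Bool
lastIs β [] = false
lastIs β (a ∷ []) = eqAssign a β
lastIs β (_ ∷ a ∷ as) = lastIs β (a ∷ as)

stepsOK : ∀ {k} → List (Assignment k) → Bool
stepsOK [] = true
stepsOK (_ ∷ []) = true
stepsOK (a ∷ b ∷ bs) = (hamming a b ℕ.≤ᵇ 1) ∧ stepsOK (b ∷ bs)

noRepeat : ∀ {k} → List (Assignment k) → Bool
noRepeat [] = true
noRepeat (_ ∷ []) = true
noRepeat (a ∷ b ∷ bs) = not (eqAssign a b) ∧ noRepeat (b ∷ bs)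

isReconf : ∀ {k} → Assignment k → Assignment k → List (Assignment k) → Bool
isReconf α β σ = headIs α σ ∧ lastIs β σ ∧ stepsOK σ

-- for variable i, some threshold t (number of leading positions, 0 ≤ t ≤ T) such that
-- the first t entries have value α(x_i) and all later entries have value β(x_i)
-- (this is the paper's t_i, positions counted from 1: α^(p) for p ≤ t_i vs p > t_i)
thresholdOK : ∀ {k} → Assignment k → Assignment k → List (Assignment k) → Fin k → Bool
thresholdOK α β σ i =
  BL.any (λ t → BL.all (λ pa → if proj₁ pa <ᵇ t
                                then V.lookup (proj₂ pa) i == V.lookup α i
                                else V.lookup (proj₂ pa) i == V.lookup β i)
                     (L.zip (upTo (length σ)) σ))
        (upTo (suc (length σ)))

isIrredundant : ∀ {k} → Assignment k → Assignment k → List (Assignment k) → Bool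
isIrredundant {k} α β σ =
  isReconf α β σ ∧ noRepeat σ ∧ BL.all (thresholdOK α β σ) (allFin k)

allAssign : (k : ℕ) → List (Assignment k)
allAssign zero = [] ∷ []
allAssign (suc k) = L.map (false ∷_) (allAssign k) ++ L.map (true ∷_) (allAssign k)

listsUpTo : ∀ {A : Set} → ℕ → List A → List (List A)
listsUpTo zero xs = [] ∷ []
listsUpTo (suc n) xs = [] ∷ concatMap (λ x → L.map (x ∷_) (listsUpTo n xs)) xs

-- Every irredundant sequence changes each variable
-- at most once and each step changes exactly one variable, so its length is ≤ k+1;
-- hence enumerating candidate lists of length ≤ k+1 yields all of 𝒜(α ⇝ β).
irredundantSeqs : ∀ {k} → Assignment k → Assignment k → List (List (Assignment k))
irredundantSeqs {k} α β = filter (λ σ → T? (isIrredundant α β σ))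
                                 (listsUpTo (suc k) (allAssign k))

-- n / d as a rational (d = 0 never occurs in use below since 𝒜 is nonempty)
frac : ℕ → ℕ → ℚ
frac n zero = 0ℚ
frac n (suc d) = (+ n) / suc d

sumℚ : List ℚ → ℚ
sumℚ = foldr ℚ._+_ 0ℚ

indicator : Bool → ℚ
indicator true = 1ℚ
indicator false = 0ℚ

-- Pr[α⃗₁ ∘ α⃗₂ satisfies C] where α_rand uniform on {0,1}^V and, given α_rand,
-- α⃗₁, α⃗₂ independent uniform from 𝒜(αs ⇝ α_rand), 𝒜(α_rand ⇝ αe).
probConcatSat : ∀ {k} → Clause k → Assignment k → Assignment k → ℚ
probConcatSat {k} C αs αe =
  sumℚ (L.map (λ r →
    let A₁ = irredundantSeqs αs r
        A₂ = irredundantSeqs r αe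
    in frac 1 (2 ℕ.^ k) ℚ.*
       sumℚ (L.map (λ s₁ → sumℚ (L.map (λ s₂ →
              frac 1 (length A₁) ℚ.* frac 1 (length A₂) ℚ.* indicator (seqSatisfies (s₁ ++ s₂) C))
            A₂)) A₁))
    (allAssign k))

formula : ℕ → ℚ
formula K = sumℚ (L.map (λ j →
    frac 1 2 ℚ.* frac (Comb._C_ K j) (2 ℕ.^ K) ℚ.* (frac j (suc j) ℚ.* frac j (suc j) ℚ.+ 1ℚ))
  (upTo (suc K)))

{-# OPTIONS --safe #-}
-- Irredundant sequences from α to β are exactly the geodesics of the hypercube, i.e. the orderings
-- of the d = hamming α β variables on which α and β differ, so there are d! of them. Such a geodesic
-- violates C only if no literal true at α lies on a fixed variable and all f falling literals (true
-- at α) are flipped before all r rising ones; hence exactly f! r! of them fail.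
-- For α = αstart = αend with a single true literal, the two halves of the concatenation are
-- independent given r and, by symmetry, satisfy C with the same probability: 1 if r keeps the true
-- literal, and j/(j+1) otherwise, where j ~ Bin(K, 1/2) counts the other variables r flips.
-- For the bound, x ≤ (x² + 1)/2 at x = j/(j+1) together with (j+1)·C(K+1,j+1) = (K+1)·C(K,j) bounds
-- the formula from below by Σ_j C(K+1,j+1)·j / ((K+1)·2^K) = 1 − 2/(K+1) + 1/((K+1)·2^K).
module Submission where

open import Defs
open import Algebra.Bundles using (CommutativeSemiring; CommutativeRing)
open import Data.Bool using (Bool; true; false; _∧_; _∨_; not; if_then_else_)
import Data.Bool.Properties as Bool
import Data.Bool.ListAction as BL
open import Data.Empty using (⊥-elim)
open import Data.Fin using (Fin; zero; suc)
open import Data.List as L using (List; []; _∷_; _++_; length; filter; concatMap; foldr; upTo; applyUpTo; allFin; tabulate; zip)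
import Data.List.Properties as LP
open import Data.List.Membership.Propositional using (_∈_)
open import Data.List.Membership.Propositional.Properties using (∈-allFin)
open import Data.List.Relation.Unary.Any using (here; there)
import Data.Integer as ℤ
import Data.Integer.Properties as ℤP
open import Data.Nat as ℕ using (ℕ; zero; suc; NonZero; _≤_; _∸_; z≤n; s≤s; _!; _<ᵇ_)
import Data.Nat.Properties as ℕP
open import Data.Nat.Properties using (_!≢0)
open import Data.Rational as ℚ using (ℚ; 0ℚ; 1ℚ; toℚᵘ)
import Data.Rational.Properties as ℚP
open import Data.Rational.Unnormalised as ℚᵘ using (mkℚᵘ; *≡*; *≤*)
import Data.Rational.Unnormalised.Properties as ℚᵘP
open import Data.Product using (_×_; _,_; proj₁; proj₂)
open import Data.Sum using (_⊎_; inj₁; inj₂)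
open import Data.Vec as V using ([]; _∷_)
open import Function using (_∘_; mk⇔)
open import Relation.Binary.PropositionalEquality
open import Relation.Nullary.Decidable.Core using (T?; yes; no)

∧-elim : ∀ {a b} → a ∧ b ≡ true → a ≡ true × b ≡ true
∧-elim {true} {true} refl = refl , refl

∧-intro : ∀ {a b} → a ≡ true → b ≡ true → a ∧ b ≡ true
∧-intro refl refl = refl

∨-elim : ∀ {a b} → a ∨ b ≡ true → a ≡ true ⊎ b ≡ true
∨-elim {true} _ = inj₁ refl
∨-elim {false} b = inj₂ b

∨-introˡ : ∀ {a b} → a ≡ true → a ∨ b ≡ true
∨-introˡ refl = refl

∨-introʳ : ∀ {a b} → b ≡ true → a ∨ b ≡ true
∨-introʳ {true} _ = refl
∨-introʳ {false} b = b

∨-mapʳ : ∀ {a b c} → (b ≡ true → c ≡ true) → a ∨ b ≡ true → a ∨ c ≡ true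
∨-mapʳ {true} f _ = refl
∨-mapʳ {false} f h = f h

not-true : ∀ {a} → not a ≡ true → a ≡ false
not-true {false} _ = refl

==⇒≡ : ∀ {a b} → (a == b) ≡ true → a ≡ b
==⇒≡ {true} {true} _ = refl
==⇒≡ {false} {false} _ = refl

≢⇒==false : ∀ {a b} → a ≢ b → (a == b) ≡ false
≢⇒==false {true} {true} a≢b = ⊥-elim (a≢b refl)
≢⇒==false {true} {false} _ = refl
≢⇒==false {false} {true} _ = refl
≢⇒==false {false} {false} a≢b = ⊥-elim (a≢b refl)

==-refl : ∀ a → (a == a) ≡ true
==-refl true = refl
==-refl false = refl

all⇒∈ : ∀ {A : Set} {p : A → Bool} {xs : List A} {x} → BL.all p xs ≡ true → x ∈ xs → p x ≡ true
all⇒∈ h (here refl) = proj₁ (∧-elim h)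
all⇒∈ h (there x∈xs) = all⇒∈ (proj₂ (∧-elim h)) x∈xs

all-intro : ∀ {A : Set} {p : A → Bool} (xs : List A) → (∀ x → p x ≡ true) → BL.all p xs ≡ true
all-intro [] _ = refl
all-intro (x ∷ xs) h = ∧-intro (h x) (all-intro xs h)

eqAssign⇒≡ : ∀ {k} (α β : Assignment k) → eqAssign α β ≡ true → α ≡ β
eqAssign⇒≡ [] [] _ = refl
eqAssign⇒≡ (a ∷ α) (b ∷ β) h = cong₂ _∷_ (==⇒≡ (proj₁ (∧-elim h))) (eqAssign⇒≡ α β (proj₂ (∧-elim h)))

eqAssign-refl : ∀ {k} (α : Assignment k) → eqAssign α α ≡ true
eqAssign-refl [] = refl
eqAssign-refl (a ∷ α) = ∧-intro (==-refl a) (eqAssign-refl α)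

hamming-refl : ∀ {k} (α : Assignment k) → hamming α α ≡ 0
hamming-refl [] = refl
hamming-refl (a ∷ α) rewrite ==-refl a = hamming-refl α

hamming≡0⇒≡ : ∀ {k} (α β : Assignment k) → hamming α β ≡ 0 → α ≡ β
hamming≡0⇒≡ [] [] _ = refl
hamming≡0⇒≡ (true ∷ α) (true ∷ β) h = cong (true ∷_) (hamming≡0⇒≡ α β h)
hamming≡0⇒≡ (false ∷ α) (false ∷ β) h = cong (false ∷_) (hamming≡0⇒≡ α β h)

hamming≡suc⇒eqAssign≡false : ∀ {k} (α β : Assignment k) {d} → hamming α β ≡ suc d → eqAssign α β ≡ false
hamming≡suc⇒eqAssign≡false α β h with eqAssign α β in e
... | false = refl
... | true with refl ← eqAssign⇒≡ α β e with () ← trans (sym (hamming-refl α)) h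

hamming≤ : ∀ {k} (α β : Assignment k) → hamming α β ≤ k
hamming≤ [] [] = z≤n
hamming≤ (true ∷ α) (true ∷ β) = ℕP.m≤n⇒m≤1+n (hamming≤ α β)
hamming≤ (false ∷ α) (false ∷ β) = ℕP.m≤n⇒m≤1+n (hamming≤ α β)
hamming≤ (true ∷ α) (false ∷ β) = s≤s (hamming≤ α β)
hamming≤ (false ∷ α) (true ∷ β) = s≤s (hamming≤ α β)

<ᵇ1⇒≡0 : ∀ n → (n <ᵇ 1) ≡ true → n ≡ 0
<ᵇ1⇒≡0 zero _ = refl

hamming<ᵇ1⇒eqAssign : ∀ {k} (α β : Assignment k) → (hamming α β <ᵇ 1) ≡ true → eqAssign β α ≡ true
hamming<ᵇ1⇒eqAssign α β h =
  subst (λ γ → eqAssign β γ ≡ true) (sym (hamming≡0⇒≡ α β (<ᵇ1⇒≡0 (hamming α β) h))) (eqAssign-refl β)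

module SumMap {c ℓ} (R : CommutativeSemiring c ℓ) where

  open CommutativeSemiring R renaming (refl to ≈-refl; sym to ≈-sym; trans to ≈-trans)
  open import Algebra.Properties.CommutativeSemigroup +-commutativeSemigroup using (interchange)

  sumMap : {A : Set} → (A → Carrier) → List A → Carrier
  sumMap f xs = foldr _+_ 0# (L.map f xs)

  module _ {A : Set} where

    sumMap-cong : {f g : A → Carrier} (xs : List A) → (∀ x → f x ≈ g x) → sumMap f xs ≈ sumMap g xs
    sumMap-cong [] _ = ≈-refl
    sumMap-cong (x ∷ xs) h = +-cong (h x) (sumMap-cong xs h)

    sumMap-++ : (f : A → Carrier) (xs ys : List A) → sumMap f (xs ++ ys) ≈ sumMap f xs + sumMap f ys
    sumMap-++ f [] ys = ≈-sym (+-identityˡ _)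
    sumMap-++ f (x ∷ xs) ys = ≈-trans (+-congˡ (sumMap-++ f xs ys)) (≈-sym (+-assoc (f x) _ _))

    sumMap-map : {B : Set} (f : A → Carrier) (g : B → A) (xs : List B) → sumMap f (L.map g xs) ≡ sumMap (f ∘ g) xs
    sumMap-map f g xs = cong (foldr _+_ 0#) (sym (LP.map-∘ xs))

    sumMap-+ : (f g : A → Carrier) (xs : List A) → sumMap (λ x → f x + g x) xs ≈ sumMap f xs + sumMap g xs
    sumMap-+ f g [] = ≈-sym (+-identityˡ 0#)
    sumMap-+ f g (x ∷ xs) = ≈-trans (+-congˡ (sumMap-+ f g xs)) (interchange (f x) (g x) _ _)

    sumMap-*ˡ : (a : Carrier) (f : A → Carrier) (xs : List A) → sumMap (λ x → a * f x) xs ≈ a * sumMap f xs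
    sumMap-*ˡ a f [] = ≈-sym (zeroʳ a)
    sumMap-*ˡ a f (x ∷ xs) = ≈-trans (+-congˡ (sumMap-*ˡ a f xs)) (≈-sym (distribˡ a (f x) _))

    sumMap-*ʳ : (a : Carrier) (f : A → Carrier) (xs : List A) → sumMap (λ x → f x * a) xs ≈ sumMap f xs * a
    sumMap-*ʳ a f [] = ≈-sym (zeroˡ a)
    sumMap-*ʳ a f (x ∷ xs) = ≈-trans (+-congˡ (sumMap-*ʳ a f xs)) (≈-sym (distribʳ a (f x) _))

    sumMap-zero : {f : A → Carrier} (xs : List A) → (∀ x → f x ≈ 0#) → sumMap f xs ≈ 0#
    sumMap-zero [] _ = ≈-refl
    sumMap-zero (x ∷ xs) h = ≈-trans (+-cong (h x) (sumMap-zero xs h)) (+-identityˡ 0#)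

  sumMap-product : {A B : Set} (f : A → Carrier) (g : B → Carrier) (xs : List A) (ys : List B) →
    sumMap (λ x → sumMap (λ y → f x * g y) ys) xs ≈ sumMap f xs * sumMap g ys
  sumMap-product f g xs ys = ≈-trans (sumMap-cong xs (λ x → sumMap-*ˡ (f x) g ys)) (sumMap-*ʳ (sumMap g ys) f xs)

  sumMap-allAssign : ∀ {k} (f : Assignment (suc k) → Carrier) →
    sumMap f (allAssign (suc k)) ≈ sumMap (f ∘ (false ∷_)) (allAssign k) + sumMap (f ∘ (true ∷_)) (allAssign k)
  sumMap-allAssign {k} f = ≈-trans (sumMap-++ f (L.map (false ∷_) (allAssign k)) (L.map (true ∷_) (allAssign k)))
    (+-cong (reflexive (sumMap-map f (false ∷_) (allAssign k))) (reflexive (sumMap-map f (true ∷_) (allAssign k))))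

  sumMap-upTo-suc : ∀ (f : ℕ → Carrier) n → sumMap f (upTo (suc n)) ≡ f 0 + sumMap (f ∘ suc) (upTo n)
  sumMap-upTo-suc f n = cong (λ xs → f 0 + foldr _+_ 0# xs) (trans (LP.map-applyUpTo suc f n) (sym (LP.map-upTo (f ∘ suc) n)))

  sumMap-upTo-∷ʳ : ∀ (f : ℕ → Carrier) n → sumMap f (upTo (suc n)) ≈ sumMap f (upTo n) + f n
  sumMap-upTo-∷ʳ f n = ≈-trans (reflexive (cong (sumMap f) (sym (LP.upTo-∷ʳ n))))
                               (≈-trans (sumMap-++ f (upTo n) (n ∷ [])) (+-congˡ (+-identityʳ (f n))))

open SumMap ℕP.+-*-commutativeSemiring using ()
  renaming (sumMap to sumℕ; sumMap-cong to sumℕ-cong; sumMap-++ to sumℕ-++; sumMap-map to sumℕ-map;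
            sumMap-+ to sumℕ-+; sumMap-*ˡ to sumℕ-*ˡ; sumMap-zero to sumℕ-zero;
            sumMap-allAssign to sumℕ-allAssign; sumMap-upTo-suc to sumℕ-upTo-suc; sumMap-upTo-∷ʳ to sumℕ-upTo-∷ʳ)

indicatorℕ : Bool → ℕ
indicatorℕ true = 1
indicatorℕ false = 0

count : {A : Set} → (A → Bool) → List A → ℕ
count p = sumℕ (indicatorℕ ∘ p)

module _ {A : Set} where

  open import Data.Nat.Base using (_+_; _*_)
  open import Algebra.Properties.CommutativeSemigroup ℕP.+-commutativeSemigroup using (x∙yz≈y∙xz)

  length-filter : (p : A → Bool) (xs : List A) → length (filter (T? ∘ p) xs) ≡ count p xs
  length-filter p [] = refl
  length-filter p (x ∷ xs) with p x
  ... | true = cong suc (length-filter p xs)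
  ... | false = length-filter p xs

  count-filter : (p q : A → Bool) (xs : List A) → count q (filter (T? ∘ p) xs) ≡ count (λ x → p x ∧ q x) xs
  count-filter p q [] = refl
  count-filter p q (x ∷ xs) with p x
  ... | true = cong (indicatorℕ (q x) +_) (count-filter p q xs)
  ... | false = count-filter p q xs

  count-concatMap : {B : Set} (p : A → Bool) (f : B → List A) (ys : List B) →
    count p (concatMap f ys) ≡ sumℕ (count p ∘ f) ys
  count-concatMap p f [] = refl
  count-concatMap p f (y ∷ ys) =
    trans (sumℕ-++ (indicatorℕ ∘ p) (f y) (concatMap f ys)) (cong (count p (f y) +_) (count-concatMap p f ys))

  count-∧ : (s : Bool) (p q : A → Bool) (xs : List A) →
    count (λ x → (s ∧ p x) ∧ q x) xs ≡ (if s then count (λ x → p x ∧ q x) xs else 0)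
  count-∧ true p q xs = refl
  count-∧ false p q xs = sumℕ-zero xs (λ _ → refl)

  sum-if-const : (p : A → Bool) (f : A → ℕ) {c : ℕ} (xs : List A) → (∀ x → p x ≡ true → f x ≡ c) →
    sumℕ (λ x → if p x then f x else 0) xs ≡ count p xs * c
  sum-if-const p f [] h = refl
  sum-if-const p f (x ∷ xs) h with p x in px
  ... | true = cong₂ _+_ (h x px) (sum-if-const p f xs h)
  ... | false = sum-if-const p f xs h

  sum-if-+ : (p : A → Bool) (f g : A → ℕ) (xs : List A) →
    sumℕ (λ x → if p x then f x else 0) xs + sumℕ (λ x → if p x then g x else 0) xs ≡
    sumℕ (λ x → if p x then f x + g x else 0) xs
  sum-if-+ p f g xs = trans (sym (sumℕ-+ _ _ xs)) (sumℕ-cong xs pointwise)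
    where
    pointwise : ∀ x → (if p x then f x else 0) + (if p x then g x else 0) ≡ (if p x then f x + g x else 0)
    pointwise x with p x
    ... | true = refl
    ... | false = refl

  sum-if-split : (p q : A → Bool) (f : A → ℕ) (xs : List A) →
    sumℕ (λ x → if p x then f x else 0) xs ≡
    sumℕ (λ x → if p x ∧ q x then f x else 0) xs + sumℕ (λ x → if p x ∧ not (q x) then f x else 0) xs
  sum-if-split p q f [] = refl
  sum-if-split p q f (x ∷ xs) with p x | q x
  ... | true | true = trans (cong (f x +_) (sum-if-split p q f xs)) (sym (ℕP.+-assoc (f x) _ _))
  ... | true | false = trans (cong (f x +_) (sum-if-split p q f xs))
                             (x∙yz≈y∙xz (f x) (sumℕ (λ x → if p x ∧ q x then f x else 0) xs) _)
  ... | false | _ = sum-if-split p q f xs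

count-const-true : {A : Set} (xs : List A) → length xs ≡ count (λ _ → true) xs
count-const-true [] = refl
count-const-true (x ∷ xs) = cong suc (count-const-true xs)

count-listsUpTo : {A : Set} (p : List A → Bool) (n : ℕ) (xs : List A) →
  count p (listsUpTo (suc n) xs) ≡ indicatorℕ (p []) ℕ.+ sumℕ (λ x → count (p ∘ (x ∷_)) (listsUpTo n xs)) xs
count-listsUpTo p n xs = cong (indicatorℕ (p []) ℕ.+_)
  (trans (count-concatMap p (λ x → L.map (x ∷_) (listsUpTo n xs)) xs)
         (sumℕ-cong xs (λ x → sumℕ-map (indicatorℕ ∘ p) (x ∷_) (listsUpTo n xs))))

count-allAssign : ∀ {k} (p : Assignment (suc k) → Bool) →
  count p (allAssign (suc k)) ≡ count (p ∘ (false ∷_)) (allAssign k) ℕ.+ count (p ∘ (true ∷_)) (allAssign k)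
count-allAssign p = sumℕ-allAssign (indicatorℕ ∘ p)

sumℕ-allAssign-at : ∀ {k} (α : Assignment k) (f : Assignment k → ℕ) →
  sumℕ (λ β → if eqAssign β α then f β else 0) (allAssign k) ≡ f α
sumℕ-allAssign-at [] f = ℕP.+-identityʳ (f [])
sumℕ-allAssign-at {suc k} (false ∷ α) f = trans (sumℕ-allAssign (λ β → if eqAssign β (false ∷ α) then f β else 0))
  (trans (cong₂ ℕ._+_ (sumℕ-allAssign-at α (f ∘ (false ∷_))) (sumℕ-zero (allAssign k) (λ _ → refl))) (ℕP.+-identityʳ _))
sumℕ-allAssign-at {suc k} (true ∷ α) f = trans (sumℕ-allAssign (λ β → if eqAssign β (true ∷ α) then f β else 0))
  (cong₂ ℕ._+_ (sumℕ-zero (allAssign k) (λ _ → refl)) (sumℕ-allAssign-at α (f ∘ (true ∷_))))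

private
  toℚᵘ-frac : ∀ a b → toℚᵘ (frac a (suc b)) ℚᵘ.≃ mkℚᵘ (ℤ.+ a) b
  toℚᵘ-frac a b = ℚP.toℚᵘ-fromℚᵘ (mkℚᵘ (ℤ.+ a) b)

frac-cross : ∀ a b c d .{{_ : NonZero b}} .{{_ : NonZero d}} → a ℕ.* d ≡ c ℕ.* b → frac a b ≡ frac c d
frac-cross a (suc b) c (suc d) eq = ℚP.fromℚᵘ-cong same
  where
  same : mkℚᵘ (ℤ.+ a) b ℚᵘ.≃ mkℚᵘ (ℤ.+ c) d
  same = *≡* (trans (sym (ℤP.pos-* a (suc d))) (trans (cong ℤ.+_ eq) (ℤP.pos-* c (suc b))))

frac-≤ : ∀ a b c d .{{_ : NonZero b}} .{{_ : NonZero d}} → a ℕ.* d ≤ c ℕ.* b → frac a b ℚ.≤ frac c d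
frac-≤ a (suc b) c (suc d) le = ℚP.toℚᵘ-cancel-≤
  (ℚᵘP.≤-respʳ-≃ (ℚᵘP.≃-sym (toℚᵘ-frac c d)) (ℚᵘP.≤-respˡ-≃ (ℚᵘP.≃-sym (toℚᵘ-frac a b))
    (*≤* (subst₂ ℤ._≤_ (ℤP.pos-* a (suc d)) (ℤP.pos-* c (suc b)) (ℤ.+≤+ le)))))

frac-* : ∀ a b c d → frac a b ℚ.* frac c d ≡ frac (a ℕ.* c) (b ℕ.* d)
frac-* a zero c d = ℚP.*-zeroˡ (frac c d)
frac-* a (suc b) c zero = trans (ℚP.*-zeroʳ (frac a (suc b))) (cong (frac (a ℕ.* c)) (sym (ℕP.*-zeroʳ b)))
frac-* a (suc b) c (suc d) = ℚP.toℚᵘ-injective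
  (ℚᵘP.≃-trans (ℚP.toℚᵘ-homo-* (frac a (suc b)) (frac c (suc d)))
  (ℚᵘP.≃-trans (ℚᵘP.*-cong (toℚᵘ-frac a b) (toℚᵘ-frac c d))
  (ℚᵘP.≃-trans (ℚᵘP.≃-reflexive (cong (λ n → mkℚᵘ n (d ℕ.+ b ℕ.* suc d)) (sym (ℤP.pos-* a c))))
               (ℚᵘP.≃-sym (toℚᵘ-frac (a ℕ.* c) (d ℕ.+ b ℕ.* suc d))))))

frac-+ : ∀ a b c d .{{_ : NonZero b}} .{{_ : NonZero d}} →
  frac a b ℚ.+ frac c d ≡ frac (a ℕ.* d ℕ.+ c ℕ.* b) (b ℕ.* d)
frac-+ a (suc b) c (suc d) = ℚP.toℚᵘ-injective
  (ℚᵘP.≃-trans (ℚP.toℚᵘ-homo-+ (frac a (suc b)) (frac c (suc d)))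
  (ℚᵘP.≃-trans (ℚᵘP.+-cong (toℚᵘ-frac a b) (toℚᵘ-frac c d))
  (ℚᵘP.≃-trans (ℚᵘP.≃-reflexive (cong (λ n → mkℚᵘ n (d ℕ.+ b ℕ.* suc d)) (sym numerator)))
               (ℚᵘP.≃-sym (toℚᵘ-frac (a ℕ.* suc d ℕ.+ c ℕ.* suc b) (d ℕ.+ b ℕ.* suc d))))))
  where
  numerator : ℤ.+ (a ℕ.* suc d ℕ.+ c ℕ.* suc b) ≡ ℤ.+ a ℤ.* ℤ.+ suc d ℤ.+ ℤ.+ c ℤ.* ℤ.+ suc b
  numerator = trans (ℤP.pos-+ (a ℕ.* suc d) (c ℕ.* suc b)) (cong₂ ℤ._+_ (ℤP.pos-* a (suc d)) (ℤP.pos-* c (suc b)))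

frac-0 : ∀ b → frac 0 b ≡ 0ℚ
frac-0 zero = refl
frac-0 (suc b) = ℚP.0/n≡0 (suc b)

frac-+-same : ∀ a c D .{{_ : NonZero D}} → frac a D ℚ.+ frac c D ≡ frac (a ℕ.+ c) D
frac-+-same a c D = trans (frac-+ a D c D) (frac-cross _ (D ℕ.* D) (a ℕ.+ c) D {{ℕP.m*n≢0 D D}} rearrange)
  where
  rearrange : (a ℕ.* D ℕ.+ c ℕ.* D) ℕ.* D ≡ (a ℕ.+ c) ℕ.* (D ℕ.* D)
  rearrange = trans (cong (ℕ._* D) (sym (ℕP.*-distribʳ-+ D a c))) (ℕP.*-assoc (a ℕ.+ c) D D)

open SumMap (CommutativeRing.commutativeSemiring ℚP.+-*-commutativeRing) using ()
  renaming (sumMap-cong to sumℚ-cong; sumMap-*ˡ to sumℚ-*ˡ; sumMap-product to sumℚ-product; sumMap-+ to sumℚ-+;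
            sumMap-upTo-suc to sumℚ-upTo-suc; sumMap-upTo-∷ʳ to sumℚ-upTo-∷ʳ; sumMap-allAssign to sumℚ-allAssign)

sumℚ-indicator : {A : Set} (p : A → Bool) (xs : List A) → sumℚ (L.map (indicator ∘ p) xs) ≡ frac (count p xs) 1
sumℚ-indicator p [] = refl
sumℚ-indicator p (x ∷ xs) with p x
... | true = trans (cong (1ℚ ℚ.+_) (sumℚ-indicator p xs)) (frac-+-same 1 (count p xs) 1)
... | false = trans (ℚP.+-identityˡ _) (sumℚ-indicator p xs)

sumℚ-frac : {A : Set} (a : A → ℕ) (D : ℕ) .{{_ : NonZero D}} (xs : List A) →
  sumℚ (L.map (λ x → frac (a x) D) xs) ≡ frac (sumℕ a xs) D
sumℚ-frac a D [] = sym (frac-0 D)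
sumℚ-frac a D (x ∷ xs) = trans (cong (frac (a x) D ℚ.+_) (sumℚ-frac a D xs)) (frac-+-same (a x) (sumℕ a xs) D)

sumℚ-mono-≤ : {A : Set} {f g : A → ℚ} (xs : List A) → (∀ x → f x ℚ.≤ g x) →
  sumℚ (L.map f xs) ℚ.≤ sumℚ (L.map g xs)
sumℚ-mono-≤ [] _ = ℚP.≤-refl
sumℚ-mono-≤ (x ∷ xs) h = ℚP.+-mono-≤ (h x) (sumℚ-mono-≤ xs h)

module _ where

  open import Data.Nat.Base using (_+_; _*_; _^_)
  open import Data.Nat.Combinatorics using (_C_; nCk+nC[k+1]≡[n+1]C[k+1]; k>n⇒nCk≡0; nC1≡n)
  open import Data.Nat.Solver using (module +-*-Solver)
  open +-*-Solver

  sum-C-suc : ∀ n → 1 + sumℕ (λ j → n C suc j) (upTo (suc n)) ≡ sumℕ (n C_) (upTo (suc n))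
  sum-C-suc n = begin
      1 + sumℕ (λ j → n C suc j) (upTo (suc n))
    ≡⟨ cong (1 +_) (sumℕ-upTo-∷ʳ (λ j → n C suc j) n) ⟩
      1 + (sumℕ (λ j → n C suc j) (upTo n) + n C suc n)
    ≡⟨ cong (λ c → 1 + (sumℕ (λ j → n C suc j) (upTo n) + c)) (k>n⇒nCk≡0 (ℕP.n<1+n n)) ⟩
      1 + (sumℕ (λ j → n C suc j) (upTo n) + 0)
    ≡⟨ cong (1 +_) (ℕP.+-identityʳ _) ⟩
      1 + sumℕ (λ j → n C suc j) (upTo n)
    ≡⟨ sym (sumℕ-upTo-suc (n C_) n) ⟩
      sumℕ (n C_) (upTo (suc n)) ∎
    where open ≡-Reasoning

  sum-binomial : ∀ n → sumℕ (n C_) (upTo (suc n)) ≡ 2 ^ n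
  sum-binomial zero = refl
  sum-binomial (suc n) = begin
      sumℕ (suc n C_) (upTo (suc (suc n)))
    ≡⟨ sumℕ-upTo-suc (suc n C_) (suc n) ⟩
      1 + sumℕ (λ j → suc n C suc j) (upTo (suc n))
    ≡⟨ cong (1 +_) (sumℕ-cong (upTo (suc n)) (λ j → sym (nCk+nC[k+1]≡[n+1]C[k+1] n j))) ⟩
      1 + sumℕ (λ j → n C j + n C suc j) (upTo (suc n))
    ≡⟨ cong (1 +_) (sumℕ-+ (n C_) (λ j → n C suc j) (upTo (suc n))) ⟩
      1 + (sumℕ (n C_) (upTo (suc n)) + sumℕ (λ j → n C suc j) (upTo (suc n)))
    ≡⟨ x∙yz≈y∙xz 1 (sumℕ (n C_) (upTo (suc n))) _ ⟩
      sumℕ (n C_) (upTo (suc n)) + (1 + sumℕ (λ j → n C suc j) (upTo (suc n)))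
    ≡⟨ cong (sumℕ (n C_) (upTo (suc n)) +_) (sum-C-suc n) ⟩
      sumℕ (n C_) (upTo (suc n)) + sumℕ (n C_) (upTo (suc n))
    ≡⟨ cong₂ _+_ (sum-binomial n) (trans (sum-binomial n) (sym (ℕP.+-identityʳ (2 ^ n)))) ⟩
      2 ^ suc n ∎
    where
    open ≡-Reasoning
    open import Algebra.Properties.CommutativeSemigroup ℕP.+-commutativeSemigroup using (x∙yz≈y∙xz)

  suc-*-C-suc : ∀ n j → suc j * (suc n C suc j) ≡ suc n * (n C j)
  suc-*-C-suc zero zero = refl
  suc-*-C-suc zero (suc j) rewrite k>n⇒nCk≡0 {1} {suc (suc j)} (s≤s (s≤s z≤n)) | k>n⇒nCk≡0 {0} {suc j} (s≤s z≤n) =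
    ℕP.*-zeroʳ (suc (suc j))
  suc-*-C-suc (suc m) zero = trans (ℕP.*-identityˡ _) (trans (nC1≡n (suc (suc m))) (sym (ℕP.*-identityʳ (suc (suc m)))))
  suc-*-C-suc (suc m) (suc j) = begin
      suc (suc j) * (suc (suc m) C suc (suc j))
    ≡⟨ cong (suc (suc j) *_) (sym (nCk+nC[k+1]≡[n+1]C[k+1] (suc m) (suc j))) ⟩
      suc (suc j) * (X + Y)
    ≡⟨ solve 3 (λ j X Y → (con 2 :+ j) :* (X :+ Y) := X :+ ((con 1 :+ j) :* X :+ (con 2 :+ j) :* Y)) refl j X Y ⟩
      X + (suc j * X + suc (suc j) * Y)
    ≡⟨ cong (X +_) (cong₂ _+_ (suc-*-C-suc m j) (suc-*-C-suc m (suc j))) ⟩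
      X + (suc m * (m C j) + suc m * (m C suc j))
    ≡⟨ cong (X +_) (trans (sym (ℕP.*-distribˡ-+ (suc m) (m C j) (m C suc j))) (cong (suc m *_) (nCk+nC[k+1]≡[n+1]C[k+1] m j))) ⟩
      suc (suc m) * X ∎
    where
    open ≡-Reasoning
    X Y : ℕ
    X = suc m C suc j
    Y = suc m C suc (suc j)

  sum-C-suc-* : ∀ K → sumℕ (λ j → (suc K C suc j) * j) (upTo (suc K)) + 2 ^ suc K ≡ suc (suc K * 2 ^ K)
  sum-C-suc-* K = begin
      A + 2 ^ suc K
    ≡⟨ cong (A +_) (trans (sym (sum-binomial (suc K))) (sumℕ-upTo-suc (suc K C_) (suc K))) ⟩
      A + (1 + B)
    ≡⟨ trans (ℕP.+-suc A B) (cong suc (ℕP.+-comm A B)) ⟩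
      suc (B + A)
    ≡⟨ cong suc (sym (sumℕ-+ (λ j → suc K C suc j) (λ j → (suc K C suc j) * j) (upTo (suc K)))) ⟩
      suc (sumℕ (λ j → suc K C suc j + (suc K C suc j) * j) (upTo (suc K)))
    ≡⟨ cong suc (sumℕ-cong (upTo (suc K)) absorb) ⟩
      suc (sumℕ (λ j → suc K * (K C j)) (upTo (suc K)))
    ≡⟨ cong suc (trans (sumℕ-*ˡ (suc K) (K C_) (upTo (suc K))) (cong (suc K *_) (sum-binomial K))) ⟩
      suc (suc K * 2 ^ K) ∎
    where
    open ≡-Reasoning
    A B : ℕ
    A = sumℕ (λ j → (suc K C suc j) * j) (upTo (suc K))
    B = sumℕ (λ j → suc K C suc j) (upTo (suc K))
    absorb : ∀ j → suc K C suc j + (suc K C suc j) * j ≡ suc K * (K C j)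
    absorb j = trans (sym (ℕP.*-suc (suc K C suc j) j)) (trans (ℕP.*-comm (suc K C suc j) (suc j)) (suc-*-C-suc K j))

module _ where

  open import Data.Nat.Combinatorics using (_C_; nCk+nC[k+1]≡[n+1]C[k+1]; k>n⇒nCk≡0)
  open import Data.Rational.Base using (_+_; _*_)
  open import Algebra.Properties.CommutativeSemigroup (CommutativeRing.+-commutativeSemigroup ℚP.+-*-commutativeRing)
    using (xy∙z≈x∙zy)

  binomialSum : ℕ → (ℕ → ℚ) → ℚ
  binomialSum m G = sumℚ (L.map (λ j → frac (m C j) 1 * G j) (upTo (suc m)))

  binomialSum-+ : ∀ m F G → binomialSum m F + binomialSum m G ≡ binomialSum m (λ j → F j + G j)
  binomialSum-+ m F G = trans (sym (sumℚ-+ (λ j → frac (m C j) 1 * F j) (λ j → frac (m C j) 1 * G j) (upTo (suc m))))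
                              (sumℚ-cong (upTo (suc m)) (λ j → sym (ℚP.*-distribˡ-+ (frac (m C j) 1) (F j) (G j))))

  binomialSum-pascal : ∀ m G → binomialSum m G + binomialSum m (G ∘ suc) ≡ binomialSum (suc m) G
  binomialSum-pascal m G = begin
      binomialSum m G + binomialSum m (G ∘ suc)
    ≡⟨ cong (_+ binomialSum m (G ∘ suc)) lowerHalf ⟩
      (G 0 + upper (suc m)) + binomialSum m (G ∘ suc)
    ≡⟨ xy∙z≈x∙zy (G 0) (upper (suc m)) (binomialSum m (G ∘ suc)) ⟩
      G 0 + (binomialSum m (G ∘ suc) + upper (suc m))
    ≡⟨ cong (G 0 +_) (trans (sym (sumℚ-+ (λ j → frac (m C j) 1 * G (suc j)) (λ j → frac (m C suc j) 1 * G (suc j))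
                                         (upTo (suc m))))
                            (sumℚ-cong (upTo (suc m)) pascal)) ⟩
      G 0 + sumℚ (L.map (λ j → frac (suc m C suc j) 1 * G (suc j)) (upTo (suc m)))
    ≡⟨ cong (_+ sumℚ (L.map (λ j → frac (suc m C suc j) 1 * G (suc j)) (upTo (suc m)))) (sym (ℚP.*-identityˡ (G 0))) ⟩
      1ℚ * G 0 + sumℚ (L.map (λ j → frac (suc m C suc j) 1 * G (suc j)) (upTo (suc m)))
    ≡⟨ sym (sumℚ-upTo-suc (λ j → frac (suc m C j) 1 * G j) (suc m)) ⟩
      binomialSum (suc m) G ∎
    where
    open ≡-Reasoning
    upper : ℕ → ℚ
    upper n = sumℚ (L.map (λ j → frac (m C suc j) 1 * G (suc j)) (upTo n))
    vanishing : frac (m C suc m) 1 * G (suc m) ≡ 0ℚ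
    vanishing = trans (cong (λ c → frac c 1 * G (suc m)) (k>n⇒nCk≡0 (ℕP.n<1+n m))) (ℚP.*-zeroˡ (G (suc m)))
    lowerHalf : binomialSum m G ≡ G 0 + upper (suc m)
    lowerHalf = begin
        binomialSum m G
      ≡⟨ sumℚ-upTo-suc (λ j → frac (m C j) 1 * G j) m ⟩
        1ℚ * G 0 + upper m
      ≡⟨ cong₂ _+_ (ℚP.*-identityˡ (G 0)) (sym (ℚP.+-identityʳ (upper m))) ⟩
        G 0 + (upper m + 0ℚ)
      ≡⟨ cong (λ z → G 0 + (upper m + z)) (sym vanishing) ⟩
        G 0 + (upper m + frac (m C suc m) 1 * G (suc m))
      ≡⟨ cong (G 0 +_) (sym (sumℚ-upTo-∷ʳ (λ j → frac (m C suc j) 1 * G (suc j)) m)) ⟩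
        G 0 + upper (suc m) ∎
    pascal : ∀ j → frac (m C j) 1 * G (suc j) + frac (m C suc j) 1 * G (suc j) ≡ frac (suc m C suc j) 1 * G (suc j)
    pascal j = trans (sym (ℚP.*-distribʳ-+ (G (suc j)) (frac (m C j) 1) (frac (m C suc j) 1)))
                     (cong (_* G (suc j)) (trans (frac-+-same (m C j) (m C suc j) 1)
                                                 (cong (λ c → frac c 1) (nCk+nC[k+1]≡[n+1]C[k+1] m j))))

  sum-hamming : ∀ {m} (α : Assignment m) (G : ℕ → ℚ) → sumℚ (L.map (G ∘ hamming α) (allAssign m)) ≡ binomialSum m G
  sum-hamming [] G = cong (_+ 0ℚ) (sym (ℚP.*-identityˡ (G 0)))
  sum-hamming {suc m} (false ∷ α) G = trans (sumℚ-allAssign (G ∘ hamming (false ∷ α)))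
    (trans (cong₂ _+_ (sum-hamming α G) (sum-hamming α (G ∘ suc))) (binomialSum-pascal m G))
  sum-hamming {suc m} (true ∷ α) G = trans (sumℚ-allAssign (G ∘ hamming (true ∷ α)))
    (trans (cong₂ _+_ (sum-hamming α (G ∘ suc)) (sum-hamming α G))
           (trans (ℚP.+-comm (binomialSum m (G ∘ suc)) (binomialSum m G)) (binomialSum-pascal m G)))

module _ {A : Set} (P Q : A → Bool) where

  twoPhase : List A → Bool
  twoPhase [] = true
  twoPhase (a ∷ σ) = BL.all Q (a ∷ σ) ∨ (P a ∧ twoPhase σ)

  phasesAt : ℕ → List ℕ → List A → Bool
  phasesAt t is σ = BL.all (λ pa → if proj₁ pa <ᵇ t then P (proj₂ pa) else Q (proj₂ pa)) (zip is σ)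

  threshold : List A → ℕ → Bool
  threshold σ t = phasesAt t (upTo (length σ)) σ

  private

    phasesAt-suc : ∀ t is σ → phasesAt (suc t) (L.map suc is) σ ≡ phasesAt t is σ
    phasesAt-suc t [] σ = refl
    phasesAt-suc t (i ∷ is) [] = refl
    phasesAt-suc t (i ∷ is) (a ∷ σ) = cong ((if i <ᵇ t then P a else Q a) ∧_) (phasesAt-suc t is σ)

    phasesAt-zero : ∀ is σ → length is ≡ length σ → phasesAt 0 is σ ≡ BL.all Q σ
    phasesAt-zero [] [] _ = refl
    phasesAt-zero (i ∷ is) (a ∷ σ) e = cong (Q a ∧_) (phasesAt-zero is σ (ℕP.suc-injective e))

    any-const∧ : ∀ b (f : ℕ → Bool) xs → BL.any (λ t → b ∧ f t) xs ≡ b ∧ BL.any f xs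
    any-const∧ true f xs = refl
    any-const∧ false f [] = refl
    any-const∧ false f (x ∷ xs) = any-const∧ false f xs

    threshold-suc : ∀ a σ t → threshold (a ∷ σ) (suc t) ≡ P a ∧ threshold σ t
    threshold-suc a σ t =
      cong (P a ∧_) (trans (cong (λ is → phasesAt (suc t) is σ) (sym (LP.map-upTo suc (length σ))))
                           (phasesAt-suc t (upTo (length σ)) σ))

  any-threshold≡twoPhase : ∀ σ → BL.any (threshold σ) (upTo (suc (length σ))) ≡ twoPhase σ
  any-threshold≡twoPhase [] = refl
  any-threshold≡twoPhase (a ∷ σ) = begin
      BL.any (threshold (a ∷ σ)) (upTo (suc (suc n)))
    ≡⟨ cong₂ _∨_ (cong (Q a ∧_) (phasesAt-zero (applyUpTo suc n) σ (LP.length-applyUpTo suc n)))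
                 (cong BL.or (trans (cong (L.map (threshold (a ∷ σ))) (sym (LP.map-upTo suc (suc n))))
                                    (sym (LP.map-∘ (upTo (suc n)))))) ⟩
      BL.all Q (a ∷ σ) ∨ BL.any (threshold (a ∷ σ) ∘ suc) (upTo (suc n))
    ≡⟨ cong (BL.all Q (a ∷ σ) ∨_) (trans (cong BL.or (LP.map-cong (threshold-suc a σ) (upTo (suc n))))
                                         (any-const∧ (P a) (threshold σ) (upTo (suc n)))) ⟩
      BL.all Q (a ∷ σ) ∨ (P a ∧ BL.any (threshold σ) (upTo (suc n)))
    ≡⟨ cong (λ z → BL.all Q (a ∷ σ) ∨ (P a ∧ z)) (any-threshold≡twoPhase σ) ⟩
      twoPhase (a ∷ σ) ∎
    where
    open ≡-Reasoning
    n : ℕ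
    n = length σ

module _ {A : Set} {P Q : A → Bool} where

  twoPhase-tail : ∀ a σ → twoPhase P Q (a ∷ σ) ≡ true → twoPhase P Q σ ≡ true
  twoPhase-tail a [] _ = refl
  twoPhase-tail a (b ∷ σ) t with ∨-elim {BL.all Q (a ∷ b ∷ σ)} t
  ... | inj₁ qs = ∨-introˡ (proj₂ (∧-elim {Q a} qs))
  ... | inj₂ pt = proj₂ (∧-elim {P a} pt)

  twoPhase-onlyQ : ∀ a σ → twoPhase P Q (a ∷ σ) ≡ true → P a ≡ false → BL.all Q (a ∷ σ) ≡ true
  twoPhase-onlyQ a σ t pa with ∨-elim {BL.all Q (a ∷ σ)} t
  ... | inj₁ qs = qs
  ... | inj₂ pt with () ← trans (sym pa) (proj₁ (∧-elim {P a} pt))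

stepToward : ∀ {k} → Assignment k → Assignment k → Assignment k → Bool
stepToward [] [] [] = false
stepToward (a ∷ α) (c ∷ β) (x ∷ b) = if x == a then stepToward α β b else ((x == c) ∧ eqAssign b α)

geodesicFrom : ∀ {k} → Assignment k → Assignment k → List (Assignment k) → Bool
geodesicFrom α β [] = eqAssign α β
geodesicFrom α β (b ∷ τ) = stepToward α β b ∧ geodesicFrom b β τ

isGeodesic : ∀ {k} → Assignment k → Assignment k → List (Assignment k) → Bool
isGeodesic α β [] = false
isGeodesic α β (a ∷ τ) = eqAssign a α ∧ geodesicFrom α β τ

stepToward-lookup : ∀ {k} (α β b : Assignment k) → stepToward α β b ≡ true → ∀ i →
  V.lookup b i ≡ V.lookup α i ⊎ V.lookup b i ≡ V.lookup β i
stepToward-lookup (true ∷ α) (c ∷ β) (true ∷ b) h zero = inj₁ refl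
stepToward-lookup (false ∷ α) (c ∷ β) (false ∷ b) h zero = inj₁ refl
stepToward-lookup (true ∷ α) (c ∷ β) (false ∷ b) h zero = inj₂ (==⇒≡ (proj₁ (∧-elim {false == c} h)))
stepToward-lookup (false ∷ α) (c ∷ β) (true ∷ b) h zero = inj₂ (==⇒≡ (proj₁ (∧-elim {true == c} h)))
stepToward-lookup (true ∷ α) (c ∷ β) (true ∷ b) h (suc i) = stepToward-lookup α β b h i
stepToward-lookup (false ∷ α) (c ∷ β) (false ∷ b) h (suc i) = stepToward-lookup α β b h i
stepToward-lookup (true ∷ α) (c ∷ β) (false ∷ b) h (suc i) =
  inj₁ (cong (λ v → V.lookup v i) (eqAssign⇒≡ b α (proj₂ (∧-elim {false == c} h))))
stepToward-lookup (false ∷ α) (c ∷ β) (true ∷ b) h (suc i) =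
  inj₁ (cong (λ v → V.lookup v i) (eqAssign⇒≡ b α (proj₂ (∧-elim {true == c} h))))

stepToward⇒eqAssign : ∀ {k} (α β b : Assignment k) → stepToward α β b ≡ true → eqAssign α b ≡ false
stepToward⇒eqAssign [] [] [] ()
stepToward⇒eqAssign (true ∷ α) (c ∷ β) (true ∷ b) h = stepToward⇒eqAssign α β b h
stepToward⇒eqAssign (false ∷ α) (c ∷ β) (false ∷ b) h = stepToward⇒eqAssign α β b h
stepToward⇒eqAssign (true ∷ α) (c ∷ β) (false ∷ b) h = refl
stepToward⇒eqAssign (false ∷ α) (c ∷ β) (true ∷ b) h = refl

stepToward⇒hamming≡1 : ∀ {k} (α β b : Assignment k) → stepToward α β b ≡ true → hamming α b ≡ 1
stepToward⇒hamming≡1 [] [] [] ()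
stepToward⇒hamming≡1 (true ∷ α) (c ∷ β) (true ∷ b) h = stepToward⇒hamming≡1 α β b h
stepToward⇒hamming≡1 (false ∷ α) (c ∷ β) (false ∷ b) h = stepToward⇒hamming≡1 α β b h
stepToward⇒hamming≡1 (true ∷ α) (c ∷ β) (false ∷ b) h =
  cong suc (trans (cong (hamming α) (eqAssign⇒≡ b α (proj₂ (∧-elim {false == c} h)))) (hamming-refl α))
stepToward⇒hamming≡1 (false ∷ α) (c ∷ β) (true ∷ b) h =
  cong suc (trans (cong (hamming α) (eqAssign⇒≡ b α (proj₂ (∧-elim {true == c} h)))) (hamming-refl α))

stepToward-intro : ∀ {k} (α β b : Assignment k) → (hamming α b ℕ.≤ᵇ 1) ≡ true → eqAssign α b ≡ false →
  (∀ i → V.lookup b i ≡ V.lookup α i ⊎ V.lookup b i ≡ V.lookup β i) → stepToward α β b ≡ true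
stepToward-intro [] [] [] _ () _
stepToward-intro (true ∷ α) (c ∷ β) (true ∷ b) h e p = stepToward-intro α β b h e (p ∘ suc)
stepToward-intro (false ∷ α) (c ∷ β) (false ∷ b) h e p = stepToward-intro α β b h e (p ∘ suc)
stepToward-intro (true ∷ α) (c ∷ β) (false ∷ b) h e p with p zero
... | inj₂ refl = ∧-intro refl (hamming<ᵇ1⇒eqAssign α b h)
stepToward-intro (false ∷ α) (c ∷ β) (true ∷ b) h e p with p zero
... | inj₂ refl = ∧-intro refl (hamming<ᵇ1⇒eqAssign α b h)

agreesAt : ∀ {k} → Fin k → Bool → Assignment k → Bool
agreesAt i x a = V.lookup a i == x

thresholdOK≡twoPhase : ∀ {k} (α β : Assignment k) σ i →
  thresholdOK α β σ i ≡ twoPhase (agreesAt i (V.lookup α i)) (agreesAt i (V.lookup β i)) σ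
thresholdOK≡twoPhase α β σ i = any-threshold≡twoPhase _ _ σ

twoPhase-next : ∀ {k} i y (a b : Assignment k) τ → twoPhase (agreesAt i (V.lookup a i)) (agreesAt i y) (b ∷ τ) ≡ true →
  (V.lookup b i ≡ V.lookup a i ⊎ V.lookup b i ≡ y) × twoPhase (agreesAt i (V.lookup b i)) (agreesAt i y) (b ∷ τ) ≡ true
twoPhase-next i y a b τ t with V.lookup b i Bool.≟ V.lookup a i
... | yes b=a = inj₁ b=a , subst (λ z → twoPhase (agreesAt i z) (agreesAt i y) (b ∷ τ) ≡ true) (sym b=a) t
... | no b≠a = inj₂ (==⇒≡ (proj₁ (∧-elim only-y))) , ∨-introˡ only-y
  where
  only-y : BL.all (agreesAt i y) (b ∷ τ) ≡ true
  only-y = twoPhase-onlyQ b τ t (≢⇒==false b≠a)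

module _ {k : ℕ} (β : Assignment k) where

  geodesicFrom⇒lastIs : ∀ α τ → geodesicFrom α β τ ≡ true → lastIs β (α ∷ τ) ≡ true
  geodesicFrom⇒lastIs α [] g = g
  geodesicFrom⇒lastIs α (b ∷ τ) g = geodesicFrom⇒lastIs b τ (proj₂ (∧-elim {stepToward α β b} g))

  geodesicFrom⇒stepsOK : ∀ α τ → geodesicFrom α β τ ≡ true → stepsOK (α ∷ τ) ≡ true
  geodesicFrom⇒stepsOK α [] g = refl
  geodesicFrom⇒stepsOK α (b ∷ τ) g with ∧-elim {stepToward α β b} g
  ... | s , g′ rewrite stepToward⇒hamming≡1 α β b s = geodesicFrom⇒stepsOK b τ g′

  geodesicFrom⇒noRepeat : ∀ α τ → geodesicFrom α β τ ≡ true → noRepeat (α ∷ τ) ≡ true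
  geodesicFrom⇒noRepeat α [] g = refl
  geodesicFrom⇒noRepeat α (b ∷ τ) g with ∧-elim {stepToward α β b} g
  ... | s , g′ rewrite stepToward⇒eqAssign α β b s = geodesicFrom⇒noRepeat b τ g′

  geodesicFrom-stays : ∀ i α τ → geodesicFrom α β τ ≡ true → V.lookup α i ≡ V.lookup β i →
    BL.all (agreesAt i (V.lookup β i)) (α ∷ τ) ≡ true
  geodesicFrom-stays i α τ g e = ∧-intro (subst (λ x → (x == V.lookup β i) ≡ true) (sym e) (==-refl (V.lookup β i))) (rest τ g)
    where
    rest : ∀ τ → geodesicFrom α β τ ≡ true → BL.all (agreesAt i (V.lookup β i)) τ ≡ true
    rest [] _ = refl
    rest (b ∷ τ) g with ∧-elim {stepToward α β b} g
    ... | s , g′ with stepToward-lookup α β b s i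
    ...   | inj₁ b=α = geodesicFrom-stays i b τ g′ (trans b=α e)
    ...   | inj₂ b=β = geodesicFrom-stays i b τ g′ b=β

  geodesicFrom⇒twoPhase : ∀ i x α τ → geodesicFrom α β τ ≡ true → agreesAt i x α ≡ true →
    twoPhase (agreesAt i x) (agreesAt i (V.lookup β i)) (α ∷ τ) ≡ true
  geodesicFrom⇒twoPhase i x α [] g h = ∨-introʳ (∧-intro h refl)
  geodesicFrom⇒twoPhase i x α (b ∷ τ) g h with ∧-elim {stepToward α β b} g
  ... | s , g′ with stepToward-lookup α β b s i
  ...   | inj₁ b=α = ∨-introʳ (∧-intro h (geodesicFrom⇒twoPhase i x b τ g′ (trans (cong (_== x) b=α) h)))
  ...   | inj₂ b=β = ∨-introʳ (∧-intro h (∨-introˡ (geodesicFrom-stays i b τ g′ b=β)))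

  isGeodesic⇒isIrredundant : ∀ α σ → isGeodesic α β σ ≡ true → isIrredundant α β σ ≡ true
  isGeodesic⇒isIrredundant α (a ∷ τ) h with ∧-elim {eqAssign a α} h
  ... | e , g with eqAssign⇒≡ a α e
  ... | refl = ∧-intro (∧-intro (eqAssign-refl α) (∧-intro (geodesicFrom⇒lastIs α τ g) (geodesicFrom⇒stepsOK α τ g)))
                       (∧-intro (geodesicFrom⇒noRepeat α τ g) (all-intro (allFin k) thresholds))
    where
    thresholds : ∀ i → thresholdOK α β (α ∷ τ) i ≡ true
    thresholds i = trans (thresholdOK≡twoPhase α β (α ∷ τ) i)
                         (geodesicFrom⇒twoPhase i (V.lookup α i) α τ g (==-refl (V.lookup α i)))

  conditions⇒geodesicFrom : ∀ α τ →
    lastIs β (α ∷ τ) ≡ true → stepsOK (α ∷ τ) ≡ true → noRepeat (α ∷ τ) ≡ true →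
    (∀ i → twoPhase (agreesAt i (V.lookup α i)) (agreesAt i (V.lookup β i)) (α ∷ τ) ≡ true) → geodesicFrom α β τ ≡ true
  conditions⇒geodesicFrom α [] l _ _ _ = l
  conditions⇒geodesicFrom α (b ∷ τ) l s n t =
    ∧-intro (stepToward-intro α β b (proj₁ (∧-elim s)) (not-true (proj₁ (∧-elim n))) (proj₁ ∘ next))
            (conditions⇒geodesicFrom b τ l (proj₂ (∧-elim s)) (proj₂ (∧-elim n)) (proj₂ ∘ next))
    where
    next : ∀ i → (V.lookup b i ≡ V.lookup α i ⊎ V.lookup b i ≡ V.lookup β i) ×
                 twoPhase (agreesAt i (V.lookup b i)) (agreesAt i (V.lookup β i)) (b ∷ τ) ≡ true
    next i = twoPhase-next i (V.lookup β i) α b τ (twoPhase-tail {P = agreesAt i (V.lookup α i)} α (b ∷ τ) (t i))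

  isIrredundant⇒isGeodesic : ∀ α σ → isIrredundant α β σ ≡ true → isGeodesic α β σ ≡ true
  isIrredundant⇒isGeodesic α (a ∷ τ) h with ∧-elim {isReconf α β (a ∷ τ)} h
  ... | r , rest with ∧-elim {eqAssign a α} r | ∧-elim {noRepeat (a ∷ τ)} rest
  ... | e , ls | nr , th with eqAssign⇒≡ a α e
  ... | refl = ∧-intro (eqAssign-refl α)
                 (conditions⇒geodesicFrom α τ (proj₁ (∧-elim ls)) (proj₂ (∧-elim ls)) nr
                   (λ i → trans (sym (thresholdOK≡twoPhase α β (α ∷ τ) i)) (all⇒∈ th (∈-allFin i))))

  isIrredundant≡isGeodesic : ∀ α σ → isIrredundant α β σ ≡ isGeodesic α β σ
  isIrredundant≡isGeodesic α σ = Bool.⇔→≡ (mk⇔ (isIrredundant⇒isGeodesic α σ) (isGeodesic⇒isIrredundant α σ))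

sat : ∀ {k} → Clause k → Assignment k → Bool
sat [] [] = false
sat (c ∷ C) (a ∷ α) = (c == a) ∨ sat C α

trueLits : ∀ {k} → Clause k → Assignment k → ℕ
trueLits [] [] = 0
trueLits (c ∷ C) (a ∷ α) = indicatorℕ (c == a) ℕ.+ trueLits C α

keepsTrueLit : ∀ {k} → Clause k → Assignment k → Assignment k → Bool
keepsTrueLit [] [] [] = false
keepsTrueLit (c ∷ C) (a ∷ α) (b ∷ β) = ((a == b) ∧ (c == a)) ∨ keepsTrueLit C α β

fallingLits : ∀ {k} → Clause k → Assignment k → Assignment k → ℕ
fallingLits [] [] [] = 0
fallingLits (c ∷ C) (a ∷ α) (b ∷ β) = indicatorℕ (not (a == b) ∧ (c == a)) ℕ.+ fallingLits C α β

risingLits : ∀ {k} → Clause k → Assignment k → Assignment k → ℕ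
risingLits [] [] [] = 0
risingLits (c ∷ C) (a ∷ α) (b ∷ β) = indicatorℕ (not (a == b) ∧ not (c == a)) ℕ.+ risingLits C α β

flipsTrueLit : ∀ {k} → Clause k → Assignment k → Assignment k → Bool
flipsTrueLit [] [] [] = false
flipsTrueLit (c ∷ C) (a ∷ α) (x ∷ b) = if x == a then flipsTrueLit C α b else (c == a)

satisfies≡sat : ∀ {k} (C : Clause k) α → satisfies α C ≡ sat C α
satisfies≡sat {k} C α = trans (cong BL.or (LP.map-tabulate (λ i → i) (litTrue C α))) (or-tabulate C α)
  where
  or-tabulate : ∀ {k} (C : Clause k) α → BL.or (tabulate (litTrue C α)) ≡ sat C α
  or-tabulate [] [] = refl
  or-tabulate (c ∷ C) (a ∷ α) = cong ((c == a) ∨_) (or-tabulate C α)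

numTrueLits≡trueLits : ∀ {k} (C : Clause k) α → numTrueLits C α ≡ trueLits C α
numTrueLits≡trueLits {k} C α =
  trans (length-filter (litTrue C α) (allFin k))
        (trans (cong (foldr ℕ._+_ 0) (LP.map-tabulate (λ i → i) (indicatorℕ ∘ litTrue C α))) (sum-tabulate C α))
  where
  sum-tabulate : ∀ {k} (C : Clause k) α → foldr ℕ._+_ 0 (tabulate (indicatorℕ ∘ litTrue C α)) ≡ trueLits C α
  sum-tabulate [] [] = refl
  sum-tabulate (c ∷ C) (a ∷ α) = cong (indicatorℕ (c == a) ℕ.+_) (sum-tabulate C α)

sat≡false⇒trueLits≡0 : ∀ {k} (C : Clause k) α → sat C α ≡ false → trueLits C α ≡ 0
sat≡false⇒trueLits≡0 [] [] _ = refl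
sat≡false⇒trueLits≡0 (c ∷ C) (a ∷ α) h with c == a
... | false = sat≡false⇒trueLits≡0 C α h

trueLits≡0⇒sat≡false : ∀ {k} (C : Clause k) α → trueLits C α ≡ 0 → sat C α ≡ false
trueLits≡0⇒sat≡false [] [] _ = refl
trueLits≡0⇒sat≡false (c ∷ C) (a ∷ α) h with c == a
... | false = trueLits≡0⇒sat≡false C α h

keepsTrueLit-refl : ∀ {k} (C : Clause k) α → keepsTrueLit C α α ≡ sat C α
keepsTrueLit-refl [] [] = refl
keepsTrueLit-refl (c ∷ C) (a ∷ α) rewrite ==-refl a = cong ((c == a) ∨_) (keepsTrueLit-refl C α)

keepsTrueLit-sym : ∀ {k} (C : Clause k) α β → keepsTrueLit C α β ≡ keepsTrueLit C β α
keepsTrueLit-sym [] [] [] = refl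
keepsTrueLit-sym (c ∷ C) (true ∷ α) (true ∷ β) = cong (_ ∨_) (keepsTrueLit-sym C α β)
keepsTrueLit-sym (c ∷ C) (false ∷ α) (false ∷ β) = cong (_ ∨_) (keepsTrueLit-sym C α β)
keepsTrueLit-sym (c ∷ C) (true ∷ α) (false ∷ β) = keepsTrueLit-sym C α β
keepsTrueLit-sym (c ∷ C) (false ∷ α) (true ∷ β) = keepsTrueLit-sym C α β

fallingLits-sym : ∀ {k} (C : Clause k) α β → fallingLits C β α ≡ risingLits C α β
fallingLits-sym [] [] [] = refl
fallingLits-sym (c ∷ C) (true ∷ α) (true ∷ β) = fallingLits-sym C α β
fallingLits-sym (c ∷ C) (false ∷ α) (false ∷ β) = fallingLits-sym C α β
fallingLits-sym (true ∷ C) (true ∷ α) (false ∷ β) = fallingLits-sym C α β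
fallingLits-sym (false ∷ C) (true ∷ α) (false ∷ β) = cong suc (fallingLits-sym C α β)
fallingLits-sym (true ∷ C) (false ∷ α) (true ∷ β) = cong suc (fallingLits-sym C α β)
fallingLits-sym (false ∷ C) (false ∷ α) (true ∷ β) = fallingLits-sym C α β

hamming-sym : ∀ {k} (α β : Assignment k) → hamming α β ≡ hamming β α
hamming-sym [] [] = refl
hamming-sym (true ∷ α) (true ∷ β) = hamming-sym α β
hamming-sym (false ∷ α) (false ∷ β) = hamming-sym α β
hamming-sym (true ∷ α) (false ∷ β) = cong suc (hamming-sym α β)
hamming-sym (false ∷ α) (true ∷ β) = cong suc (hamming-sym α β)

hamming≡falling+rising : ∀ {k} (C : Clause k) α β → hamming α β ≡ fallingLits C α β ℕ.+ risingLits C α β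
hamming≡falling+rising [] [] [] = refl
hamming≡falling+rising (c ∷ C) (a ∷ α) (b ∷ β) with a == b | c == a
... | true | _ = hamming≡falling+rising C α β
... | false | true = cong suc (hamming≡falling+rising C α β)
... | false | false = trans (cong suc (hamming≡falling+rising C α β)) (sym (ℕP.+-suc _ _))

¬keepsTrueLit⇒trueLits≡falling : ∀ {k} (C : Clause k) α β → keepsTrueLit C α β ≡ false →
  trueLits C α ≡ fallingLits C α β
¬keepsTrueLit⇒trueLits≡falling [] [] [] _ = refl
¬keepsTrueLit⇒trueLits≡falling (c ∷ C) (a ∷ α) (b ∷ β) h with a == b | c == a
... | true | false = ¬keepsTrueLit⇒trueLits≡falling C α β h
... | false | l = cong (indicatorℕ l ℕ.+_) (¬keepsTrueLit⇒trueLits≡falling C α β h)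

trueLits≡0⇒¬keepsTrueLit : ∀ {k} (C : Clause k) α β → trueLits C α ≡ 0 → keepsTrueLit C α β ≡ false
trueLits≡0⇒¬keepsTrueLit [] [] [] _ = refl
trueLits≡0⇒¬keepsTrueLit (c ∷ C) (a ∷ α) (b ∷ β) h with c == a
... | false rewrite Bool.∧-zeroʳ (a == b) = trueLits≡0⇒¬keepsTrueLit C α β h

trueLits≡0⇒rising≡hamming : ∀ {k} (C : Clause k) α β → trueLits C α ≡ 0 → risingLits C α β ≡ hamming α β
trueLits≡0⇒rising≡hamming [] [] [] _ = refl
trueLits≡0⇒rising≡hamming (c ∷ C) (a ∷ α) (b ∷ β) h with c == a | a == b
... | false | true = trueLits≡0⇒rising≡hamming C α β h
... | false | false = cong suc (trueLits≡0⇒rising≡hamming C α β h)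

stepToward-self : ∀ {k} (α b : Assignment k) → stepToward α α b ≡ false
stepToward-self [] [] = refl
stepToward-self (a ∷ α) (x ∷ b) with x == a
... | true = stepToward-self α b
... | false = refl

stepToward⇒hamming : ∀ {k} (α β b : Assignment k) → stepToward α β b ≡ true → suc (hamming b β) ≡ hamming α β
stepToward⇒hamming [] [] [] ()
stepToward⇒hamming (true ∷ α) (e ∷ β) (true ∷ b) h =
  trans (sym (ℕP.+-suc _ _)) (cong (_ ℕ.+_) (stepToward⇒hamming α β b h))
stepToward⇒hamming (false ∷ α) (e ∷ β) (false ∷ b) h =
  trans (sym (ℕP.+-suc _ _)) (cong (_ ℕ.+_) (stepToward⇒hamming α β b h))
stepToward⇒hamming (true ∷ α) (false ∷ β) (false ∷ b) h rewrite eqAssign⇒≡ b α h = refl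
stepToward⇒hamming (false ∷ α) (true ∷ β) (true ∷ b) h rewrite eqAssign⇒≡ b α h = refl

stepToward-keepsTrueLit : ∀ {k} (C : Clause k) α β b → stepToward α β b ≡ true →
  keepsTrueLit C α β ≡ true → keepsTrueLit C b β ≡ true
stepToward-keepsTrueLit [] [] [] [] ()
stepToward-keepsTrueLit (c ∷ C) (true ∷ α) (e ∷ β) (true ∷ b) h = ∨-mapʳ (stepToward-keepsTrueLit C α β b h)
stepToward-keepsTrueLit (c ∷ C) (false ∷ α) (e ∷ β) (false ∷ b) h = ∨-mapʳ (stepToward-keepsTrueLit C α β b h)
stepToward-keepsTrueLit (c ∷ C) (true ∷ α) (false ∷ β) (false ∷ b) h g rewrite eqAssign⇒≡ b α h = ∨-introʳ g
stepToward-keepsTrueLit (c ∷ C) (false ∷ α) (true ∷ β) (true ∷ b) h g rewrite eqAssign⇒≡ b α h = ∨-introʳ g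

fallingStep-keepsTrueLit : ∀ {k} (C : Clause k) α β b → stepToward α β b ≡ true → flipsTrueLit C α b ≡ true →
  keepsTrueLit C b β ≡ keepsTrueLit C α β
fallingStep-keepsTrueLit [] [] [] [] ()
fallingStep-keepsTrueLit (c ∷ C) (true ∷ α) (e ∷ β) (true ∷ b) h g = cong (_ ∨_) (fallingStep-keepsTrueLit C α β b h g)
fallingStep-keepsTrueLit (c ∷ C) (false ∷ α) (e ∷ β) (false ∷ b) h g = cong (_ ∨_) (fallingStep-keepsTrueLit C α β b h g)
fallingStep-keepsTrueLit (true ∷ C) (true ∷ α) (false ∷ β) (false ∷ b) h g rewrite eqAssign⇒≡ b α h = refl
fallingStep-keepsTrueLit (false ∷ C) (false ∷ α) (true ∷ β) (true ∷ b) h g rewrite eqAssign⇒≡ b α h = refl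

fallingStep-falling : ∀ {k} (C : Clause k) α β b → stepToward α β b ≡ true → flipsTrueLit C α b ≡ true →
  suc (fallingLits C b β) ≡ fallingLits C α β
fallingStep-falling [] [] [] [] ()
fallingStep-falling (c ∷ C) (true ∷ α) (e ∷ β) (true ∷ b) h g =
  trans (sym (ℕP.+-suc _ _)) (cong (_ ℕ.+_) (fallingStep-falling C α β b h g))
fallingStep-falling (c ∷ C) (false ∷ α) (e ∷ β) (false ∷ b) h g =
  trans (sym (ℕP.+-suc _ _)) (cong (_ ℕ.+_) (fallingStep-falling C α β b h g))
fallingStep-falling (true ∷ C) (true ∷ α) (false ∷ β) (false ∷ b) h g rewrite eqAssign⇒≡ b α h = refl
fallingStep-falling (false ∷ C) (false ∷ α) (true ∷ β) (true ∷ b) h g rewrite eqAssign⇒≡ b α h = refl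

fallingStep-rising : ∀ {k} (C : Clause k) α β b → stepToward α β b ≡ true → flipsTrueLit C α b ≡ true →
  risingLits C b β ≡ risingLits C α β
fallingStep-rising [] [] [] [] ()
fallingStep-rising (c ∷ C) (true ∷ α) (e ∷ β) (true ∷ b) h g = cong (_ ℕ.+_) (fallingStep-rising C α β b h g)
fallingStep-rising (c ∷ C) (false ∷ α) (e ∷ β) (false ∷ b) h g = cong (_ ℕ.+_) (fallingStep-rising C α β b h g)
fallingStep-rising (true ∷ C) (true ∷ α) (false ∷ β) (false ∷ b) h g rewrite eqAssign⇒≡ b α h = refl
fallingStep-rising (false ∷ C) (false ∷ α) (true ∷ β) (true ∷ b) h g rewrite eqAssign⇒≡ b α h = refl

risingStep-keepsTrueLit : ∀ {k} (C : Clause k) α β b → stepToward α β b ≡ true → flipsTrueLit C α b ≡ false →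
  keepsTrueLit C b β ≡ true
risingStep-keepsTrueLit [] [] [] [] ()
risingStep-keepsTrueLit (c ∷ C) (true ∷ α) (e ∷ β) (true ∷ b) h g = ∨-introʳ (risingStep-keepsTrueLit C α β b h g)
risingStep-keepsTrueLit (c ∷ C) (false ∷ α) (e ∷ β) (false ∷ b) h g = ∨-introʳ (risingStep-keepsTrueLit C α β b h g)
risingStep-keepsTrueLit (false ∷ C) (true ∷ α) (false ∷ β) (false ∷ b) h g = refl
risingStep-keepsTrueLit (true ∷ C) (false ∷ α) (true ∷ β) (true ∷ b) h g = refl

count-eqAssign : ∀ {k} (α : Assignment k) u v → count (λ b → (u ∧ eqAssign b α) ∧ v) (allAssign k) ≡ indicatorℕ (u ∧ v)
count-eqAssign {k} α u v =
  trans (sumℕ-cong (allAssign k) (λ b → pointwise (eqAssign b α))) (sumℕ-allAssign-at α (λ _ → indicatorℕ (u ∧ v)))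
  where
  pointwise : ∀ e → indicatorℕ ((u ∧ e) ∧ v) ≡ (if e then indicatorℕ (u ∧ v) else 0)
  pointwise true = cong (λ w → indicatorℕ (w ∧ v)) (Bool.∧-identityʳ u)
  pointwise false = cong (λ w → indicatorℕ (w ∧ v)) (Bool.∧-zeroʳ u)

count-eqAssign′ : ∀ {k} (α : Assignment k) u → count (λ b → u ∧ eqAssign b α) (allAssign k) ≡ indicatorℕ u
count-eqAssign′ {k} α u = trans (sumℕ-cong (allAssign k) (λ b → cong indicatorℕ (sym (Bool.∧-identityʳ _))))
                           (trans (count-eqAssign α u true) (cong indicatorℕ (Bool.∧-identityʳ u)))

count-stepToward : ∀ {k} (α β : Assignment k) → count (stepToward α β) (allAssign k) ≡ hamming α β
count-stepToward [] [] = refl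
count-stepToward (true ∷ α) (true ∷ β) =
  trans (count-allAssign (stepToward (true ∷ α) (true ∷ β))) (cong₂ ℕ._+_ (count-eqAssign′ α false) (count-stepToward α β))
count-stepToward (true ∷ α) (false ∷ β) =
  trans (count-allAssign (stepToward (true ∷ α) (false ∷ β))) (cong₂ ℕ._+_ (count-eqAssign′ α true) (count-stepToward α β))
count-stepToward (false ∷ α) (true ∷ β) =
  trans (count-allAssign (stepToward (false ∷ α) (true ∷ β)))
        (trans (cong₂ ℕ._+_ (count-stepToward α β) (count-eqAssign′ α true)) (ℕP.+-comm _ 1))
count-stepToward (false ∷ α) (false ∷ β) =
  trans (count-allAssign (stepToward (false ∷ α) (false ∷ β)))
        (trans (cong₂ ℕ._+_ (count-stepToward α β) (count-eqAssign′ α false)) (ℕP.+-identityʳ _))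

count-fallingSteps : ∀ {k} (C : Clause k) α β →
  count (λ b → stepToward α β b ∧ flipsTrueLit C α b) (allAssign k) ≡ fallingLits C α β
count-fallingSteps [] [] [] = refl
count-fallingSteps (c ∷ C) (true ∷ α) (e ∷ β) =
  trans (count-allAssign (λ b → stepToward (true ∷ α) (e ∷ β) b ∧ flipsTrueLit (c ∷ C) (true ∷ α) b))
        (cong₂ ℕ._+_ (count-eqAssign α (false == e) (c == true)) (count-fallingSteps C α β))
count-fallingSteps (c ∷ C) (false ∷ α) (true ∷ β) =
  trans (count-allAssign (λ b → stepToward (false ∷ α) (true ∷ β) b ∧ flipsTrueLit (c ∷ C) (false ∷ α) b))
        (trans (cong₂ ℕ._+_ (count-fallingSteps C α β) (count-eqAssign α true (c == false))) (ℕP.+-comm (fallingLits C α β) _))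
count-fallingSteps (c ∷ C) (false ∷ α) (false ∷ β) =
  trans (count-allAssign (λ b → stepToward (false ∷ α) (false ∷ β) b ∧ flipsTrueLit (c ∷ C) (false ∷ α) b))
        (trans (cong₂ ℕ._+_ (count-fallingSteps C α β) (count-eqAssign α false (c == false))) (ℕP.+-comm (fallingLits C α β) _))

geodesicCount : ∀ {k} → ℕ → Assignment k → Assignment k → (List (Assignment k) → Bool) → ℕ
geodesicCount {k} n α β W = count (λ τ → geodesicFrom α β τ ∧ W τ) (listsUpTo n (allAssign k))

module _ {k : ℕ} where

  open import Data.Nat.Base using (_+_; _*_)

  geodesicCount-suc : ∀ n (α β : Assignment k) W → geodesicCount (suc n) α β W ≡
    indicatorℕ (eqAssign α β ∧ W []) +
    sumℕ (λ b → if stepToward α β b then geodesicCount n b β (W ∘ (b ∷_)) else 0) (allAssign k)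
  geodesicCount-suc n α β W = trans (count-listsUpTo (λ τ → geodesicFrom α β τ ∧ W τ) n (allAssign k))
    (cong (indicatorℕ (eqAssign α β ∧ W []) +_) (sumℕ-cong (allAssign k)
      (λ b → count-∧ (stepToward α β b) (geodesicFrom b β) (W ∘ (b ∷_)) (listsUpTo n (allAssign k)))))

  geodesicCount-refl : ∀ n (α : Assignment k) W → W [] ≡ true → geodesicCount n α α W ≡ 1
  geodesicCount-refl zero α W w rewrite eqAssign-refl α | w = refl
  geodesicCount-refl (suc n) α W w rewrite geodesicCount-suc n α α W | eqAssign-refl α | w =
    cong suc (sumℕ-zero (allAssign k) (λ b → cong (if_then geodesicCount n b α (W ∘ (b ∷_)) else 0) (stepToward-self α b)))

  sum-stepToward : ∀ (α β : Assignment k) (f : Assignment k → ℕ) {c} → (∀ b → stepToward α β b ≡ true → f b ≡ c) →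
    sumℕ (λ b → if stepToward α β b then f b else 0) (allAssign k) ≡ hamming α β * c
  sum-stepToward α β f {c} h = trans (sum-if-const (stepToward α β) f (allAssign k) h) (cong (_* c) (count-stepToward α β))

  geodesicCount-all : ∀ n (α β : Assignment k) → hamming α β ≤ n → geodesicCount n α β (λ _ → true) ≡ hamming α β !
  geodesicCount-all n α β d≤n with hamming α β in eh
  ... | zero with refl ← hamming≡0⇒≡ α β eh = geodesicCount-refl n α (λ _ → true) refl
  geodesicCount-all (suc n) α β (s≤s d≤n) | suc d
    rewrite geodesicCount-suc n α β (λ _ → true) | hamming≡suc⇒eqAssign≡false α β eh =
      trans (sum-stepToward α β (λ b → geodesicCount n b β (λ _ → true)) byInduction) (cong (_* d !) eh)
    where
    byInduction : ∀ b → stepToward α β b ≡ true → geodesicCount n b β (λ _ → true) ≡ d !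
    byInduction b s = let d′ = ℕP.suc-injective (trans (stepToward⇒hamming α β b s) eh) in
      trans (geodesicCount-all n b β (subst (_≤ n) (sym d′) d≤n)) (cong _! d′)

module _ {k : ℕ} (C : Clause k) where

  open import Data.Nat.Base using (_+_; _*_)

  satGeodesics : ℕ → Assignment k → Assignment k → ℕ
  satGeodesics n α β = geodesicCount n α β (λ τ → seqSatisfies (α ∷ τ) C)

  -- A geodesic fails C iff no literal true at α sits on a fixed variable and the f falling flips
  -- all precede the r rising ones.
  unsatGeodesics : Assignment k → Assignment k → ℕ
  unsatGeodesics α β = if keepsTrueLit C α β then 0 else fallingLits C α β ! * risingLits C α β !

  unsatGeodesics-keeps : ∀ α β → keepsTrueLit C α β ≡ true → unsatGeodesics α β ≡ 0
  unsatGeodesics-keeps α β h = cong (if_then 0 else fallingLits C α β ! * risingLits C α β !) h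

  unsatGeodesics-¬keeps : ∀ α β → keepsTrueLit C α β ≡ false →
    unsatGeodesics α β ≡ fallingLits C α β ! * risingLits C α β !
  unsatGeodesics-¬keeps α β h = cong (if_then 0 else fallingLits C α β ! * risingLits C α β !) h

  unsatGeodesics-sym : ∀ α β → unsatGeodesics β α ≡ unsatGeodesics α β
  unsatGeodesics-sym α β rewrite keepsTrueLit-sym C β α | fallingLits-sym C α β | sym (fallingLits-sym C β α) =
    cong (if keepsTrueLit C α β then 0 else_) (ℕP.*-comm (risingLits C α β !) (fallingLits C α β !))

  unsatGeodesics-unsat : ∀ α β → sat C α ≡ false → unsatGeodesics α β ≡ hamming α β !
  unsatGeodesics-unsat α β h = begin
      unsatGeodesics α β
    ≡⟨ unsatGeodesics-¬keeps α β ¬keeps ⟩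
      fallingLits C α β ! * risingLits C α β !
    ≡⟨ cong₂ (λ f r → f ! * r !) (trans (sym (¬keepsTrueLit⇒trueLits≡falling C α β ¬keeps)) none)
                                 (trueLits≡0⇒rising≡hamming C α β none) ⟩
      1 * hamming α β !
    ≡⟨ ℕP.*-identityˡ _ ⟩
      hamming α β ! ∎
    where
    open ≡-Reasoning
    none : trueLits C α ≡ 0
    none = sat≡false⇒trueLits≡0 C α h
    ¬keeps : keepsTrueLit C α β ≡ false
    ¬keeps = trueLits≡0⇒¬keepsTrueLit C α β none

  sum-unsatGeodesics-steps : ∀ α β → sat C α ≡ true →
    sumℕ (λ b → if stepToward α β b then unsatGeodesics b β else 0) (allAssign k) ≡ unsatGeodesics α β
  sum-unsatGeodesics-steps α β sα with keepsTrueLit C α β in kα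
  ... | true = trans (sum-stepToward α β (λ b → unsatGeodesics b β)
                       (λ b s → unsatGeodesics-keeps b β (stepToward-keepsTrueLit C α β b s kα)))
                     (ℕP.*-zeroʳ (hamming α β))
  ... | false with fallingLits C α β in fα
  ...   | zero with () ← trans (sym (trueLits≡0⇒sat≡false C α (trans (¬keepsTrueLit⇒trueLits≡falling C α β kα) fα))) sα
  ...   | suc f = begin
      sumℕ (λ b → if stepToward α β b then unsatGeodesics b β else 0) (allAssign k)
    ≡⟨ sum-if-split (stepToward α β) (flipsTrueLit C α) (λ b → unsatGeodesics b β) (allAssign k) ⟩
      sumℕ (λ b → if falling b then unsatGeodesics b β else 0) (allAssign k) +
      sumℕ (λ b → if rising b then unsatGeodesics b β else 0) (allAssign k)
    ≡⟨ cong₂ _+_ (sum-if-const falling (λ b → unsatGeodesics b β) (allAssign k) afterFalling)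
                 (sum-if-const rising (λ b → unsatGeodesics b β) (allAssign k) afterRising) ⟩
      count falling (allAssign k) * (f ! * r !) + count rising (allAssign k) * 0
    ≡⟨ cong₂ _+_ (cong (_* (f ! * r !)) (trans (count-fallingSteps C α β) fα)) (ℕP.*-zeroʳ (count rising (allAssign k))) ⟩
      suc f * (f ! * r !) + 0
    ≡⟨ trans (ℕP.+-identityʳ _) (sym (ℕP.*-assoc (suc f) (f !) (r !))) ⟩
      suc f ! * r ! ∎
    where
    open ≡-Reasoning
    r : ℕ
    r = risingLits C α β
    falling rising : Assignment k → Bool
    falling b = stepToward α β b ∧ flipsTrueLit C α b
    rising b = stepToward α β b ∧ not (flipsTrueLit C α b)
    afterFalling : ∀ b → falling b ≡ true → unsatGeodesics b β ≡ f ! * r !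
    afterFalling b h with ∧-elim {stepToward α β b} h
    ... | s , fl = trans (unsatGeodesics-¬keeps b β (trans (fallingStep-keepsTrueLit C α β b s fl) kα))
                         (cong₂ (λ f′ r′ → f′ ! * r′ !) (ℕP.suc-injective (trans (fallingStep-falling C α β b s fl) fα))
                                                       (fallingStep-rising C α β b s fl))
    afterRising : ∀ b → rising b ≡ true → unsatGeodesics b β ≡ 0
    afterRising b h with ∧-elim {stepToward α β b} h
    ... | s , rs = unsatGeodesics-keeps b β (risingStep-keepsTrueLit C α β b s (not-true rs))

  satGeodesics-unsat : ∀ n α β → sat C α ≡ false → satGeodesics n α β ≡ 0
  satGeodesics-unsat n α β h = sumℕ-zero (listsUpTo n (allAssign k)) (λ τ → cong indicatorℕ
    (trans (cong (λ s → geodesicFrom α β τ ∧ (s ∧ seqSatisfies τ C)) (trans (satisfies≡sat C α) h)) (Bool.∧-zeroʳ _)))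

  satGeodesics-sat : ∀ n α β → sat C α ≡ true → satGeodesics n α β ≡ geodesicCount n α β (λ τ → seqSatisfies τ C)
  satGeodesics-sat n α β h = sumℕ-cong (listsUpTo n (allAssign k))
    (λ τ → cong (λ s → indicatorℕ (geodesicFrom α β τ ∧ (s ∧ seqSatisfies τ C))) (trans (satisfies≡sat C α) h))

  satGeodesics+unsatGeodesics : ∀ n α β → hamming α β ≤ n → satGeodesics n α β + unsatGeodesics α β ≡ hamming α β !
  satGeodesics+unsatGeodesics n α β d≤n with sat C α Bool.≟ true
  ... | no ¬sα = cong₂ _+_ (satGeodesics-unsat n α β unsatα) (unsatGeodesics-unsat α β unsatα)
    where
    unsatα : sat C α ≡ false
    unsatα = Bool.¬-not ¬sα
  ... | yes sα with hamming α β in eh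
  ...   | zero with refl ← hamming≡0⇒≡ α β eh =
    cong₂ _+_ (trans (satGeodesics-sat n α α sα) (geodesicCount-refl n α _ refl))
              (unsatGeodesics-keeps α α (trans (keepsTrueLit-refl C α) sα))
  satGeodesics+unsatGeodesics (suc n) α β (s≤s d≤n) | yes sα | suc d = begin
      satGeodesics (suc n) α β + unsatGeodesics α β
    ≡⟨ cong₂ _+_ (trans (satGeodesics-sat (suc n) α β sα) (geodesicCount-suc n α β (λ τ → seqSatisfies τ C)))
                 (sym (sum-unsatGeodesics-steps α β sα)) ⟩
      (indicatorℕ (eqAssign α β ∧ true) + viaSteps (λ b → satGeodesics n b β)) + viaSteps (λ b → unsatGeodesics b β)
    ≡⟨ cong (λ e → (indicatorℕ (e ∧ true) + viaSteps (λ b → satGeodesics n b β)) + viaSteps (λ b → unsatGeodesics b β))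
            (hamming≡suc⇒eqAssign≡false α β eh) ⟩
      viaSteps (λ b → satGeodesics n b β) + viaSteps (λ b → unsatGeodesics b β)
    ≡⟨ sum-if-+ (stepToward α β) (λ b → satGeodesics n b β) (λ b → unsatGeodesics b β) (allAssign k) ⟩
      viaSteps (λ b → satGeodesics n b β + unsatGeodesics b β)
    ≡⟨ sum-stepToward α β (λ b → satGeodesics n b β + unsatGeodesics b β) byInduction ⟩
      hamming α β * d !
    ≡⟨ cong (_* d !) eh ⟩
      suc d ! ∎
    where
    open ≡-Reasoning
    viaSteps : (Assignment k → ℕ) → ℕ
    viaSteps f = sumℕ (λ b → if stepToward α β b then f b else 0) (allAssign k)
    byInduction : ∀ b → stepToward α β b ≡ true → satGeodesics n b β + unsatGeodesics b β ≡ d !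
    byInduction b s = let d′ = ℕP.suc-injective (trans (stepToward⇒hamming α β b s) eh) in
      trans (satGeodesics+unsatGeodesics n b β (subst (_≤ n) (sym d′) d≤n)) (cong _! d′)

count-irredundantSeqs : ∀ {k} (α β : Assignment k) (W : List (Assignment k) → Bool) →
  count W (irredundantSeqs α β) ≡ geodesicCount k α β (W ∘ (α ∷_))
count-irredundantSeqs {k} α β W = begin
    count W (irredundantSeqs α β)
  ≡⟨ count-filter (isIrredundant α β) W candidates ⟩
    count (λ σ → isIrredundant α β σ ∧ W σ) candidates
  ≡⟨ sumℕ-cong candidates (λ σ → cong (λ b → indicatorℕ (b ∧ W σ)) (isIrredundant≡isGeodesic β α σ)) ⟩
    count (λ σ → isGeodesic α β σ ∧ W σ) candidates
  ≡⟨ count-listsUpTo (λ σ → isGeodesic α β σ ∧ W σ) k (allAssign k) ⟩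
    sumℕ (λ a → count (λ τ → (eqAssign a α ∧ geodesicFrom α β τ) ∧ W (a ∷ τ)) (listsUpTo k (allAssign k))) (allAssign k)
  ≡⟨ sumℕ-cong (allAssign k) (λ a → count-∧ (eqAssign a α) (geodesicFrom α β) (W ∘ (a ∷_)) (listsUpTo k (allAssign k))) ⟩
    sumℕ (λ a → if eqAssign a α then geodesicCount k α β (W ∘ (a ∷_)) else 0) (allAssign k)
  ≡⟨ sumℕ-allAssign-at α (λ a → geodesicCount k α β (W ∘ (a ∷_))) ⟩
    geodesicCount k α β (W ∘ (α ∷_)) ∎
  where
  open ≡-Reasoning
  candidates : List (List (Assignment k))
  candidates = listsUpTo (suc k) (allAssign k)

length-irredundantSeqs : ∀ {k} (α β : Assignment k) → length (irredundantSeqs α β) ≡ hamming α β !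
length-irredundantSeqs {k} α β =
  trans (count-const-true (irredundantSeqs α β))
        (trans (count-irredundantSeqs α β (λ _ → true)) (geodesicCount-all k α β (hamming≤ α β)))

count-sat-irredundantSeqs : ∀ {k} (C : Clause k) (α β : Assignment k) →
  count (λ σ → seqSatisfies σ C) (irredundantSeqs α β) ℕ.+ unsatGeodesics C α β ≡ hamming α β !
count-sat-irredundantSeqs {k} C α β =
  trans (cong (ℕ._+ unsatGeodesics C α β) (count-irredundantSeqs α β (λ σ → seqSatisfies σ C)))
        (satGeodesics+unsatGeodesics C k α β (hamming≤ α β))

satProbability : ∀ {k} → Clause k → Assignment k → Assignment k → ℚ
satProbability C α β = frac (count (λ σ → seqSatisfies σ C) (irredundantSeqs α β)) (length (irredundantSeqs α β))

seqSatisfies-++ : ∀ {k} (C : Clause k) (σ τ : List (Assignment k)) →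
  seqSatisfies (σ ++ τ) C ≡ seqSatisfies σ C ∧ seqSatisfies τ C
seqSatisfies-++ C [] τ = refl
seqSatisfies-++ C (a ∷ σ) τ = trans (cong (satisfies a C ∧_) (seqSatisfies-++ C σ τ)) (sym (Bool.∧-assoc (satisfies a C) _ _))

indicator-∧ : ∀ a b → indicator (a ∧ b) ≡ indicator a ℚ.* indicator b
indicator-∧ true b = sym (ℚP.*-identityˡ (indicator b))
indicator-∧ false b = sym (ℚP.*-zeroˡ (indicator b))

probConcatSat≡sum-product : ∀ {k} (C : Clause k) (αs αe : Assignment k) → probConcatSat C αs αe ≡
  sumℚ (L.map (λ r → frac 1 (2 ℕ.^ k) ℚ.* (satProbability C αs r ℚ.* satProbability C r αe)) (allAssign k))
probConcatSat≡sum-product {k} C αs αe = sumℚ-cong (allAssign k) (λ r → cong (frac 1 (2 ℕ.^ k) ℚ.*_) (independent r))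
  where
  open import Data.Rational.Base using (_*_)
  open import Algebra.Properties.CommutativeSemigroup (CommutativeRing.*-commutativeSemigroup ℚP.+-*-commutativeRing)
    using (interchange)
  𝟙sat : List (Assignment k) → ℚ
  𝟙sat σ = indicator (seqSatisfies σ C)
  uniform : List (List (Assignment k)) → List (Assignment k) → ℚ
  uniform A σ = frac 1 (length A) * 𝟙sat σ
  sum-uniform : ∀ A → sumℚ (L.map (uniform A) A) ≡ frac (count (λ σ → seqSatisfies σ C) A) (length A)
  sum-uniform A = trans (sumℚ-*ˡ (frac 1 (length A)) 𝟙sat A)
    (trans (cong (frac 1 (length A) *_) (sumℚ-indicator (λ σ → seqSatisfies σ C) A))
           (trans (frac-* 1 (length A) N 1) (cong₂ frac (ℕP.*-identityˡ N) (ℕP.*-identityʳ (length A)))))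
    where
    N : ℕ
    N = count (λ σ → seqSatisfies σ C) A
  independent : ∀ r →
    let A₁ = irredundantSeqs αs r
        A₂ = irredundantSeqs r αe
    in sumℚ (L.map (λ σ₁ → sumℚ (L.map (λ σ₂ → frac 1 (length A₁) * frac 1 (length A₂) * 𝟙sat (σ₁ ++ σ₂)) A₂)) A₁)
       ≡ satProbability C αs r * satProbability C r αe
  independent r = trans (sumℚ-cong A₁ (λ σ₁ → sumℚ-cong A₂ (λ σ₂ → split σ₁ σ₂)))
                        (trans (sumℚ-product (uniform A₁) (uniform A₂) A₁ A₂) (cong₂ _*_ (sum-uniform A₁) (sum-uniform A₂)))
    where
    A₁ A₂ : List (List (Assignment k))
    A₁ = irredundantSeqs αs r
    A₂ = irredundantSeqs r αe
    split : ∀ σ₁ σ₂ →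
      frac 1 (length A₁) * frac 1 (length A₂) * 𝟙sat (σ₁ ++ σ₂) ≡ uniform A₁ σ₁ * uniform A₂ σ₂
    split σ₁ σ₂ = trans (cong (λ b → frac 1 (length A₁) * frac 1 (length A₂) * indicator b) (seqSatisfies-++ C σ₁ σ₂))
      (trans (cong (frac 1 (length A₁) * frac 1 (length A₂) *_) (indicator-∧ (seqSatisfies σ₁ C) (seqSatisfies σ₂ C)))
             (interchange (frac 1 (length A₁)) (frac 1 (length A₂)) (𝟙sat σ₁) (𝟙sat σ₂)))

module _ {k : ℕ} (C : Clause k) where

  private
    satCount : Assignment k → Assignment k → ℕ
    satCount α β = count (λ σ → seqSatisfies σ C) (irredundantSeqs α β)

  satProbability-sym : ∀ α β → satProbability C β α ≡ satProbability C α β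
  satProbability-sym α β = cong₂ frac sameCount sameLength
    where
    sameLength : length (irredundantSeqs β α) ≡ length (irredundantSeqs α β)
    sameLength = trans (length-irredundantSeqs β α) (trans (cong _! (hamming-sym β α)) (sym (length-irredundantSeqs α β)))
    sameCount : satCount β α ≡ satCount α β
    sameCount = ℕP.+-cancelʳ-≡ (unsatGeodesics C α β) (satCount β α) (satCount α β)
      (trans (cong (satCount β α ℕ.+_) (sym (unsatGeodesics-sym C α β)))
      (trans (count-sat-irredundantSeqs C β α)
      (trans (cong _! (hamming-sym β α)) (sym (count-sat-irredundantSeqs C α β)))))

  satProbability-keeps : ∀ α β → keepsTrueLit C α β ≡ true → satProbability C α β ≡ 1ℚ
  satProbability-keeps α β h = trans (cong₂ frac allSat (length-irredundantSeqs α β))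
                                     (frac-cross (hamming α β !) (hamming α β !) 1 1 {{hamming α β !≢0}} (ℕP.*-comm _ 1))
    where
    allSat : satCount α β ≡ hamming α β !
    allSat = trans (sym (ℕP.+-identityʳ _))
                   (trans (cong (satCount α β ℕ.+_) (sym (unsatGeodesics-keeps C α β h))) (count-sat-irredundantSeqs C α β))

  satProbability≡j/[1+j] : ∀ α β j → hamming α β ≡ suc j → unsatGeodesics C α β ≡ j ! →
    satProbability C α β ≡ frac j (suc j)
  satProbability≡j/[1+j] α β j d≡1+j u≡j! =
    trans (cong₂ frac sat≡j*j! (trans (length-irredundantSeqs α β) (cong _! d≡1+j)))
          (frac-cross (j ℕ.* j !) (suc j !) j (suc j) {{suc j !≢0}} rearrange)
    where
    sat≡j*j! : satCount α β ≡ j ℕ.* j !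
    sat≡j*j! = ℕP.+-cancelʳ-≡ (j !) (satCount α β) (j ℕ.* j !)
      (trans (cong (satCount α β ℕ.+_) (sym u≡j!))
      (trans (count-sat-irredundantSeqs C α β) (trans (cong _! d≡1+j) (ℕP.+-comm (j !) (j ℕ.* j !)))))
    rearrange : j ℕ.* j ! ℕ.* suc j ≡ j ℕ.* suc j !
    rearrange = trans (ℕP.*-assoc j (j !) (suc j)) (cong (j ℕ.*_) (ℕP.*-comm (j !) (suc j)))

pathProbability : Bool → ℕ → ℚ
pathProbability true j = 1ℚ
pathProbability false j = frac j (suc j)

satProbability-uniqueTrueLit : ∀ {k} (C : Clause k) α β → trueLits C α ≡ 1 →
  satProbability C α β ≡ pathProbability (keepsTrueLit C α β) (risingLits C α β)
satProbability-uniqueTrueLit C α β one with keepsTrueLit C α β in kα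
... | true = satProbability-keeps C α β kα
... | false = satProbability≡j/[1+j] C α β j d≡1+j u≡j!
  where
  j : ℕ
  j = risingLits C α β
  falling≡1 : fallingLits C α β ≡ 1
  falling≡1 = trans (sym (¬keepsTrueLit⇒trueLits≡falling C α β kα)) one
  d≡1+j : hamming α β ≡ suc j
  d≡1+j = trans (hamming≡falling+rising C α β) (cong (ℕ._+ j) falling≡1)
  u≡j! : unsatGeodesics C α β ≡ j !
  u≡j! = trans (unsatGeodesics-¬keeps C α β kα) (trans (cong (λ f → f ! ℕ.* j !) falling≡1) (ℕP.+-identityʳ (j !)))

module _ where

  open import Data.Rational.Base using (_+_)

  sum-noTrueLit : ∀ {K} (C : Clause K) α → trueLits C α ≡ 0 → (b : Bool) (G : Bool → ℕ → ℚ) →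
    sumℚ (L.map (λ r → G (b ∨ keepsTrueLit C α r) (risingLits C α r)) (allAssign K)) ≡ binomialSum K (G b)
  sum-noTrueLit {K} C α none b G = trans (sumℚ-cong (allAssign K) pointwise) (sum-hamming α (G b))
    where
    pointwise : ∀ r → G (b ∨ keepsTrueLit C α r) (risingLits C α r) ≡ G b (hamming α r)
    pointwise r = cong₂ G (trans (cong (b ∨_) (trueLits≡0⇒¬keepsTrueLit C α r none)) (Bool.∨-identityʳ b))
                          (trueLits≡0⇒rising≡hamming C α r none)

  sum-uniqueTrueLit : ∀ {K} (C : Clause (suc K)) α → trueLits C α ≡ 1 → (G : Bool → ℕ → ℚ) →
    sumℚ (L.map (λ r → G (keepsTrueLit C α r) (risingLits C α r)) (allAssign (suc K))) ≡
    binomialSum K (λ j → G true j + G false j)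
  sum-uniqueTrueLit {K} (true ∷ C) (true ∷ α) one G =
    trans (sumℚ-allAssign (λ r → G (keepsTrueLit (true ∷ C) (true ∷ α) r) (risingLits (true ∷ C) (true ∷ α) r)))
          (trans (cong₂ _+_ (sum-noTrueLit C α (ℕP.suc-injective one) false G) (sum-noTrueLit C α (ℕP.suc-injective one) true G))
                 (trans (ℚP.+-comm (binomialSum K (G false)) (binomialSum K (G true))) (binomialSum-+ K (G true) (G false))))
  sum-uniqueTrueLit {K} (false ∷ C) (false ∷ α) one G =
    trans (sumℚ-allAssign (λ r → G (keepsTrueLit (false ∷ C) (false ∷ α) r) (risingLits (false ∷ C) (false ∷ α) r)))
          (trans (cong₂ _+_ (sum-noTrueLit C α (ℕP.suc-injective one) true G) (sum-noTrueLit C α (ℕP.suc-injective one) false G))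
                 (binomialSum-+ K (G true) (G false)))
  sum-uniqueTrueLit {zero} (true ∷ []) (false ∷ []) ()
  sum-uniqueTrueLit {zero} (false ∷ []) (true ∷ []) ()
  sum-uniqueTrueLit {suc K} (true ∷ C) (false ∷ α) one G =
    trans (sumℚ-allAssign (λ r → G (keepsTrueLit (true ∷ C) (false ∷ α) r) (risingLits (true ∷ C) (false ∷ α) r)))
          (trans (cong₂ _+_ (sum-uniqueTrueLit C α one G) (sum-uniqueTrueLit C α one (λ b j → G b (suc j))))
                 (binomialSum-pascal K (λ j → G true j + G false j)))
  sum-uniqueTrueLit {suc K} (false ∷ C) (true ∷ α) one G =
    trans (sumℚ-allAssign (λ r → G (keepsTrueLit (false ∷ C) (true ∷ α) r) (risingLits (false ∷ C) (true ∷ α) r)))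
          (trans (cong₂ _+_ (sum-uniqueTrueLit C α one (λ b j → G b (suc j))) (sum-uniqueTrueLit C α one G))
                 (trans (ℚP.+-comm (binomialSum K (λ j → G true (suc j) + G false (suc j)))
                                   (binomialSum K (λ j → G true j + G false j)))
                        (binomialSum-pascal K (λ j → G true j + G false j))))

probConcatSat≡formula : ∀ K (C : Clause (suc K)) α → trueLits C α ≡ 1 → probConcatSat C α α ≡ formula K
probConcatSat≡formula K C α one = begin
    probConcatSat C α α
  ≡⟨ probConcatSat≡sum-product C α α ⟩
    sumℚ (L.map (λ r → uniform * (satProbability C α r * satProbability C r α)) (allAssign (suc K)))
  ≡⟨ sumℚ-cong (allAssign (suc K)) (λ r → cong (uniform *_) (square r)) ⟩
    sumℚ (L.map (λ r → uniform * G (keepsTrueLit C α r) (risingLits C α r)) (allAssign (suc K)))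
  ≡⟨ sumℚ-*ˡ uniform (λ r → G (keepsTrueLit C α r) (risingLits C α r)) (allAssign (suc K)) ⟩
    uniform * sumℚ (L.map (λ r → G (keepsTrueLit C α r) (risingLits C α r)) (allAssign (suc K)))
  ≡⟨ cong (uniform *_) (sum-uniqueTrueLit C α one G) ⟩
    uniform * binomialSum K (λ j → G true j + G false j)
  ≡⟨ sym (sumℚ-*ˡ uniform (λ j → frac (K Comb.C j) 1 * (G true j + G false j)) (upTo (suc K))) ⟩
    sumℚ (L.map (λ j → uniform * (frac (K Comb.C j) 1 * (G true j + G false j))) (upTo (suc K)))
  ≡⟨ sumℚ-cong (upTo (suc K)) term ⟩
    formula K ∎
  where
  open ≡-Reasoning
  open import Data.Rational.Base using (_+_; _*_)
  import Data.Nat.Combinatorics as Comb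
  uniform : ℚ
  uniform = frac 1 (2 ℕ.^ suc K)
  G : Bool → ℕ → ℚ
  G b j = pathProbability b j * pathProbability b j
  square : ∀ r → satProbability C α r * satProbability C r α ≡ G (keepsTrueLit C α r) (risingLits C α r)
  square r = trans (cong (satProbability C α r *_) (satProbability-sym C α r))
                   (cong (λ p → p * p) (satProbability-uniqueTrueLit C α r one))
  term : ∀ j → uniform * (frac (K Comb.C j) 1 * (G true j + G false j)) ≡
               frac 1 2 * frac (K Comb.C j) (2 ℕ.^ K) * (frac j (suc j) * frac j (suc j) + 1ℚ)
  term j = trans (sym (ℚP.*-assoc uniform (frac c 1) _))
                 (cong₂ _*_ (trans (frac-* 1 (2 ℕ.^ suc K) c 1) (sym (trans (frac-* 1 2 c (2 ℕ.^ K))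
                              (cong (frac (1 ℕ.* c)) (sym (ℕP.*-identityʳ (2 ℕ.^ suc K)))))))
                            (ℚP.+-comm 1ℚ (G false j)))
    where
    c : ℕ
    c = K Comb.C j

module _ where

  open import Data.Nat.Base using (_+_; _*_; _^_)
  open import Data.Nat.Combinatorics using (_C_)
  open import Data.Nat.Solver using (module +-*-Solver)
  open +-*-Solver

  formula-term-≥ : ∀ K j → frac ((suc K C suc j) * j) (2 ^ K * suc K) ℚ.≤
    frac 1 2 ℚ.* frac (K C j) (2 ^ K) ℚ.* (frac j (suc j) ℚ.* frac j (suc j) ℚ.+ 1ℚ)
  formula-term-≥ K j = subst (frac ((suc K C suc j) * j) (2 ^ K * suc K) ℚ.≤_) (sym closedForm)
    (frac-≤ ((suc K C suc j) * j) (2 ^ K * suc K) ((1 * c) * num) ((2 * P) * den) crossMultiplied)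
    where
    instance
      P≢0 : NonZero (2 ^ K)
      P≢0 = ℕP.m^n≢0 2 K
      D≢0 : NonZero (2 ^ K * suc K)
      D≢0 = ℕP.m*n≢0 (2 ^ K) (suc K)
      D′≢0 : NonZero ((2 * 2 ^ K) * ((suc j * suc j) * 1))
      D′≢0 = ℕP.m*n≢0 (2 * 2 ^ K) ((suc j * suc j) * 1)
               {{ℕP.m*n≢0 2 (2 ^ K)}} {{ℕP.m*n≢0 (suc j * suc j) 1 {{ℕP.m*n≢0 (suc j) (suc j)}}}}
    c P num den : ℕ
    c = K C j
    P = 2 ^ K
    num = j * j * 1 + 1 * (suc j * suc j)
    den = (suc j * suc j) * 1
    closedForm : frac 1 2 ℚ.* frac c P ℚ.* (frac j (suc j) ℚ.* frac j (suc j) ℚ.+ 1ℚ) ≡ frac ((1 * c) * num) ((2 * P) * den)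
    closedForm = trans (cong₂ ℚ._*_ (frac-* 1 2 c P)
                                    (trans (cong (ℚ._+ 1ℚ) (frac-* j (suc j) j (suc j))) (frac-+ (j * j) (suc j * suc j) 1 1)))
                       (frac-* (1 * c) (2 * P) num den)
    lhs : (suc K C suc j) * j * ((2 * P) * den) ≡ (suc K * c) * (P * (2 * j * suc j))
    lhs = trans (solve 3 (λ c′ j P → (c′ :* j) :* ((con 2 :* P) :* (((con 1 :+ j) :* (con 1 :+ j)) :* con 1))
                                 := (c′ :* (con 1 :+ j)) :* (P :* (con 2 :* j :* (con 1 :+ j)))) refl (suc K C suc j) j P)
                (cong (_* (P * (2 * j * suc j))) (trans (ℕP.*-comm (suc K C suc j) (suc j)) (suc-*-C-suc K j)))
    rhs : (1 * c) * num * (P * suc K) ≡ (suc K * c) * (P * (2 * j * suc j)) + (suc K * c) * P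
    rhs = solve 4 (λ c j P K → ((con 1 :* c) :* (j :* j :* con 1 :+ con 1 :* ((con 1 :+ j) :* (con 1 :+ j)))) :* (P :* (con 1 :+ K))
                               := ((con 1 :+ K) :* c) :* (P :* (con 2 :* j :* (con 1 :+ j))) :+ ((con 1 :+ K) :* c) :* P) refl c j P K
    -- j² + (j+1)² = 2j(j+1) + 1
    crossMultiplied : (suc K C suc j) * j * ((2 * P) * den) ≤ (1 * c) * num * (P * suc K)
    crossMultiplied = subst₂ _≤_ (sym lhs) (sym rhs) (ℕP.m≤m+n _ _)

  formula-≥ : ∀ K → 1ℚ ℚ.- frac 2 (suc (suc K)) ℚ.≤ formula (suc K)
  formula-≥ K = begin
      1ℚ ℚ.- frac 2 (suc (suc K))
    ≡⟨ cong (ℚ._- frac 2 (suc (suc K))) (sym split) ⟩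
      frac K (suc (suc K)) ℚ.+ frac 2 (suc (suc K)) ℚ.- frac 2 (suc (suc K))
    ≡⟨ ℚP.+-assoc (frac K (suc (suc K))) (frac 2 (suc (suc K))) (ℚ.- frac 2 (suc (suc K))) ⟩
      frac K (suc (suc K)) ℚ.+ (frac 2 (suc (suc K)) ℚ.- frac 2 (suc (suc K)))
    ≡⟨ trans (cong (frac K (suc (suc K)) ℚ.+_) (ℚP.+-inverseʳ (frac 2 (suc (suc K))))) (ℚP.+-identityʳ _) ⟩
      frac K (suc (suc K))
    ≤⟨ frac-≤ K (suc (suc K)) A D crossMultiplied ⟩
      frac A D
    ≡⟨ sym (sumℚ-frac (λ j → (suc (suc K) C suc j) * j) D (upTo (suc (suc K)))) ⟩
      sumℚ (L.map (λ j → frac ((suc (suc K) C suc j) * j) D) (upTo (suc (suc K))))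
    ≤⟨ sumℚ-mono-≤ (upTo (suc (suc K))) (formula-term-≥ (suc K)) ⟩
      formula (suc K) ∎
    where
    open ℚP.≤-Reasoning
    A D : ℕ
    A = sumℕ (λ j → (suc (suc K) C suc j) * j) (upTo (suc (suc K)))
    D = 2 ^ suc K * suc (suc K)
    instance
      D≢0 : NonZero D
      D≢0 = ℕP.m*n≢0 (2 ^ suc K) (suc (suc K)) {{ℕP.m^n≢0 2 (suc K)}}
    split : frac K (suc (suc K)) ℚ.+ frac 2 (suc (suc K)) ≡ 1ℚ
    split = trans (frac-+-same K 2 (suc (suc K)))
                  (frac-cross (K + 2) (suc (suc K)) 1 1
                              (trans (ℕP.*-identityʳ (K + 2)) (trans (ℕP.+-comm K 2) (sym (ℕP.*-identityˡ (suc (suc K)))))))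
    A≡ : A ≡ suc (K * 2 ^ suc K)
    A≡ = ℕP.+-cancelʳ-≡ (2 ^ suc (suc K)) A (suc (K * 2 ^ suc K))
           (trans (sum-C-suc-* (suc K))
                  (solve 2 (λ k q → con 1 :+ (con 2 :+ k) :* (con 2 :* q) := (con 1 :+ k :* (con 2 :* q)) :+ con 2 :* (con 2 :* q))
                         refl K (2 ^ K)))
    crossMultiplied : K * D ≤ A * suc (suc K)
    crossMultiplied = subst₂ _≤_ (ℕP.*-assoc K (2 ^ suc K) (suc (suc K))) (cong (_* suc (suc K)) (sym A≡))
                             (ℕP.m≤n+m (K * 2 ^ suc K * suc (suc K)) (suc (suc K)))

claim5p5 : (k : ℕ) → 3 ≤ k → (C : Clause k) → (αstart αend : Assignment k) →
    numTrueLits C αstart ≡ 1 → numTrueLits C αend ≡ 1 → αstart ≡ αend →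
    (probConcatSat C αstart αend ≡ formula (k ∸ 1))
    × (ℚ._-_ 1ℚ (frac 2 k) ℚ.≤ formula (k ∸ 1))
claim5p5 (suc (suc (suc K))) (s≤s (s≤s (s≤s z≤n))) C α .α one _ refl =
  probConcatSat≡formula (suc (suc K)) C α (trans (sym (numTrueLits≡trueLits C α)) one) , formula-≥ (suc K)
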